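{- Let $k,l\geq 2$, $t\geq 4l$ and $s\geq1$ be integers, let $n$ be an integer and $p$ a prime. Let $\tau\geq 0$ with $p^\tau\|k$, let $\gamma=\tau+1$ if $p>2$ or if $p=2$ and $\tau=0$, and $\gamma=\tau+2$ if $p=2$ and $\tau>0$. Let $\tau_1\geq0$ with $p^{\tau_1}\|kl$ and $\nu=2\tau_1+1$. Suppose that $s\geq\frac{p}{p-1}\gcd\big(k,p^\tau(p-1)\big)$ when $\gamma=\tau+1$, that $s\geq 2^{\tau+2}$ when $\gamma=\tau+2$ and $k>2$, and that $s\geq 5$ when $p=k=2$. Then $M^*_n(p^\nu)>0$.
   Context: For $\mathbf{x}\in\mathbb{Z}^t$ put $T(\mathbf{x})=x_1^l+\dots+x_t^l$. For $h\geq1$, $M_n^*(p^h)$ is the number of tuples $\mathbf{X}=(\mathbf{x}_1,\dots,\mathbf{x}_s)\in([1,p^h]^t)^s$ (integer entries), $\mathbf{x}_1=(x_{1,1},\dots,x_{1,t})$, such that $p\nmid x_{1,1}$, $p\nmid T(\mathbf{x}_1)$, and $n\equiv\sum_{i=1}^sT(\mathbf{x}_i)^k\pmod{p^h}$. -}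

module Defs where

open import Data.Nat using (ℕ; zero; suc; _+_; _*_; _^_; _≟_)
open import Data.Nat.Divisibility using (_∣_; _∣?_)
open import Data.Integer as ℤ using (ℤ; +_; ∣_∣)
open import Data.Bool using (Bool; false; _∧_)
open import Data.List using (List; []; _∷_; map; concatMap; upTo; length; filterᵇ)
open import Data.Vec as V using (Vec; []; _∷_)
open import Data.Product using (_×_)
open import Relation.Nullary using (¬_; yes; no)
open import Relation.Nullary.Decidable using (⌊_⌋; ¬?)

Tpow : (l : ℕ) {t : ℕ} → Vec ℕ t → ℕ
Tpow l x = V.sum (V.map (λ y → y ^ l) x)

boxVecs : (m t : ℕ) → List (Vec ℕ t)
boxVecs m zero = [] ∷ []
boxVecs m (suc t) = concatMap (λ a → map (a ∷_) (boxVecs m t)) (map suc (upTo m))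

boxTuples : (m t s : ℕ) → List (Vec (Vec ℕ t) s)
boxTuples m t zero = [] ∷ []
boxTuples m t (suc s) = concatMap (λ x → map (x ∷_) (boxTuples m t s)) (boxVecs m t)

good : (p h k l : ℕ) (n : ℤ) {t s : ℕ} → Vec (Vec ℕ t) s → Bool
good p h k l n [] = false
good p h k l n ([] ∷ X) = false
good p h k l n (x₁@(a ∷ _) ∷ X) =
  ⌊ ¬? (p ∣? a) ⌋ ∧ ⌊ ¬? (p ∣? Tpow l x₁) ⌋ ∧
  ⌊ (p ^ h) ∣? ∣ n ℤ.- + V.sum (V.map (λ x → Tpow l x ^ k) (x₁ ∷ X)) ∣ ⌋

Mstar : (k l t s : ℕ) (n : ℤ) (p h : ℕ) → ℕ
Mstar k l t s n p h = length (filterᵇ (good p h k l n) (boxTuples (p ^ h) t s))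

ExactPow : (p τ m : ℕ) → Set
ExactPow p τ m = (p ^ τ) ∣ m × ¬ ((p ^ suc τ) ∣ m)

gammaOf : (p τ : ℕ) → ℕ
gammaOf p zero = 1
gammaOf p (suc τ) with p ≟ 2
... | yes _ = suc τ + 2
... | no _ = suc τ + 1

-- Modulo p, the fibres of w ↦ w^k on units have at most gcd(k, p − 1) elements (Bézout, Fermat
-- and Lagrange's root bound), so there are r ≥ (p − 1)/gcd(k, p − 1) nonzero k-th power residues.
-- Modulo p^γ the set of sums of j k-th powers, once it stops being everything, grows by at least
-- r from j to j + 1, since a new sum x brings its whole orbit {w^k x : w a unit} along. With the
-- hypothesis on s every n is then w^k + y₁^k + … + y_{s−1}^k with w a unit (for p = k = 2 a table
-- modulo 8 does it), and Hensel's lemma lifts this to every power of p. The same holds for l with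
-- t ≥ 4l summands; writing u and each y_i as sums of l-th powers and reducing all entries into
-- [1, p^ν] gives the required tuple.

module Submission where

module Congruence where

  open import Data.Nat as ℕ using (ℕ; zero; suc; _≤_; _<_)
  import Data.Nat.DivMod as ℕDM
  import Data.Nat.Properties as ℕP
  open import Data.Nat.Divisibility as ℕD using (divides)
  open import Data.Nat.Primality using (Prime; euclidsLemma; prime⇒nonTrivial)
  open import Data.Integer using (ℤ; +_; -_; _+_; _*_; _-_; ∣_∣; 0ℤ; 1ℤ; _^_)
  import Data.Integer.Properties as ℤP
  import Data.Integer.DivMod as ℤDM
  open import Data.Integer.Tactic.RingSolver using (solve-∀)
  open import Data.Sum using (_⊎_; inj₁; inj₂; [_,_]′)
  open import Level using (0ℓ)
  open import Relation.Binary using (Setoid; IsEquivalence)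
  open import Relation.Nullary using (¬_)
  open import Data.Empty using (⊥-elim)
  open import Relation.Binary.PropositionalEquality

  infix 4 _≡_[mod_]
  record _≡_[mod_] (a b q : ℤ) : Set where
    constructor _,_
    field
      quotient : ℤ
      equation : a ≡ b + quotient * q
  infixr 4 _,_

  module _ {q : ℤ} where

    mod-refl : ∀ {a} → a ≡ a [mod q ]
    mod-refl {a} = 0ℤ , lemma a q
      where lemma : ∀ a q → a ≡ a + 0ℤ * q
            lemma = solve-∀

    mod-sym : ∀ {a b} → a ≡ b [mod q ] → b ≡ a [mod q ]
    mod-sym {b = b} (c , refl) = - c , lemma b c q
      where lemma : ∀ b c q → b ≡ (b + c * q) + (- c) * q
            lemma = solve-∀

    mod-trans : ∀ {a b d} → a ≡ b [mod q ] → b ≡ d [mod q ] → a ≡ d [mod q ]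
    mod-trans {d = d} (c , refl) (e , refl) = e + c , lemma d c e q
      where lemma : ∀ d c e q → (d + e * q) + c * q ≡ d + (e + c) * q
            lemma = solve-∀

    +-cong-mod : ∀ {a b a′ b′} → a ≡ b [mod q ] → a′ ≡ b′ [mod q ] → a + a′ ≡ b + b′ [mod q ]
    +-cong-mod {b = b} {b′ = b′} (c , refl) (e , refl) = c + e , lemma b b′ c e q
      where lemma : ∀ b d c e q → (b + c * q) + (d + e * q) ≡ (b + d) + (c + e) * q
            lemma = solve-∀

    *-cong-mod : ∀ {a b a′ b′} → a ≡ b [mod q ] → a′ ≡ b′ [mod q ] → a * a′ ≡ b * b′ [mod q ]
    *-cong-mod {b = b} {b′ = d} (c , refl) (e , refl) = c * d + b * e + c * e * q , lemma b d c e q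
      where lemma : ∀ b d c e q → (b + c * q) * (d + e * q) ≡ b * d + (c * d + b * e + c * e * q) * q
            lemma = solve-∀

    ^-cong-mod : ∀ {a b} → a ≡ b [mod q ] → ∀ n → a ^ n ≡ b ^ n [mod q ]
    ^-cong-mod h zero = mod-refl
    ^-cong-mod h (suc n) = *-cong-mod h (^-cong-mod h n)

    +-cancelʳ-mod : ∀ a {x y} → x + a ≡ y + a [mod q ] → x ≡ y [mod q ]
    +-cancelʳ-mod a {x} {y} (c , e) = c , (begin
      x                   ≡⟨ lemma a x ⟩
      x + a - a           ≡⟨ cong (_- a) e ⟩
      y + a + c * q - a   ≡⟨ lemma′ a y c q ⟩
      y + c * q           ∎)
      where
      open ≡-Reasoning
      lemma : ∀ a x → x ≡ x + a - a
      lemma = solve-∀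
      lemma′ : ∀ a y c q → y + a + c * q - a ≡ y + c * q
      lemma′ = solve-∀

    +-multiple-mod : ∀ a c → a + c * q ≡ a [mod q ]
    +-multiple-mod a c = c , refl

    mod⇒-≡0-mod : ∀ {a b} → a ≡ b [mod q ] → a - b ≡ 0ℤ [mod q ]
    mod⇒-≡0-mod {b = b} (c , refl) = c , lemma b c q
      where lemma : ∀ b c q → b + c * q - b ≡ 0ℤ + c * q
            lemma = solve-∀

    -≡0-mod⇒mod : ∀ {a b} → a - b ≡ 0ℤ [mod q ] → a ≡ b [mod q ]
    -≡0-mod⇒mod {a} {b} (c , e) = c , (begin
      a             ≡⟨ lemma a b ⟩
      b + (a - b)   ≡⟨ cong (λ z → b + z) (trans e (ℤP.+-identityˡ _)) ⟩
      b + c * q     ∎)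
      where
      open ≡-Reasoning
      lemma : ∀ a b → a ≡ b + (a - b)
      lemma = solve-∀

  mod-isEquivalence : ∀ q → IsEquivalence (λ a b → a ≡ b [mod q ])
  mod-isEquivalence q = record { refl = mod-refl ; sym = mod-sym ; trans = mod-trans }

  mod-setoid : ℤ → Setoid 0ℓ 0ℓ
  mod-setoid q = record { Carrier = ℤ ; _≈_ = λ a b → a ≡ b [mod q ] ; isEquivalence = mod-isEquivalence q }

  mod-*⇒mod : ∀ {q r a b} → a ≡ b [mod q * r ] → a ≡ b [mod q ]
  mod-*⇒mod {q} {r} {b = b} (c , refl) = c * r , lemma b c q r
    where lemma : ∀ b c q r → b + c * (q * r) ≡ b + (c * r) * q
          lemma = solve-∀

  ≡-mod-% : ∀ {p} .{{_ : ℕ.NonZero p}} a → a ≡ + (a ℤDM.% + p) [mod + p ]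
  ≡-mod-% {p} a = a ℤDM./ + p , ℤDM.a≡a%n+[a/n]*n a (+ p)

  ≡0-mod⇒∣ : ∀ {q a} → a ≡ 0ℤ [mod + q ] → q ℕD.∣ ∣ a ∣
  ≡0-mod⇒∣ {q} {a} (c , eq) =
    divides ∣ c ∣ (trans (cong ∣_∣ (trans eq (ℤP.+-identityˡ (c * + q)))) (ℤP.abs-* c (+ q)))

  ∣⇒≡0-mod : ∀ {q a} → q ℕD.∣ ∣ a ∣ → a ≡ 0ℤ [mod + q ]
  ∣⇒≡0-mod {q} {a} (divides k eq) with ℤP.+∣i∣≡i⊎+∣i∣≡-i a
  ... | inj₁ e = + k , (begin
    a               ≡⟨ e ⟨
    + ∣ a ∣         ≡⟨ cong +_ eq ⟩
    + (k ℕ.* q)     ≡⟨ ℤP.pos-* k q ⟩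
    + k * + q       ≡⟨ ℤP.+-identityˡ _ ⟨
    0ℤ + + k * + q  ∎)
    where open ≡-Reasoning
  ... | inj₂ e = - + k , (begin
    a                 ≡⟨ ℤP.neg-involutive a ⟨
    - (- a)           ≡⟨ cong -_ e ⟨
    - (+ ∣ a ∣)       ≡⟨ cong (λ z → - (+ z)) eq ⟩
    - (+ (k ℕ.* q))   ≡⟨ cong -_ (ℤP.pos-* k q) ⟩
    - (+ k * + q)     ≡⟨ ℤP.neg-distribˡ-* (+ k) (+ q) ⟩
    - (+ k) * + q     ≡⟨ ℤP.+-identityˡ _ ⟨
    0ℤ + - (+ k) * + q ∎)
    where open ≡-Reasoning

  mod-<-injective : ∀ {d x y} → x < d → y < d → + x ≡ + y [mod + d ] → x ≡ y
  mod-<-injective {d} {x} {y} x<d y<d x≡y =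
    [ (λ y≤x → ordered x<d y≤x x≡y) , (λ x≤y → sym (ordered y<d x≤y (mod-sym x≡y))) ]′ (ℕP.≤-total y x)
    where
    ordered : ∀ {x y} → x < d → y ≤ x → + x ≡ + y [mod + d ] → x ≡ y
    ordered {x} {y} x<d y≤x x≡y = ℕP.≤-antisym (ℕP.m∸n≡0⇒m≤n x∸y≡0) y≤x
      where
      instance _ = ℕ.>-nonZero (ℕP.≤-<-trans ℕ.z≤n x<d)
      d∣x∸y : d ℕD.∣ x ℕ.∸ y
      d∣x∸y = subst (λ z → d ℕD.∣ ∣ z ∣) (trans (ℤP.m-n≡m⊖n x y) (ℤP.⊖-≥ y≤x)) (≡0-mod⇒∣ (mod⇒-≡0-mod x≡y))
      x∸y≡0 : x ℕ.∸ y ≡ 0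
      x∸y≡0 = trans (sym (ℕDM.m<n⇒m%n≡m (ℕP.≤-<-trans (ℕP.m∸n≤m x y) x<d))) (ℕD.n∣m⇒m%n≡0 (x ℕ.∸ y) d d∣x∸y)

  euclidsLemma-mod : ∀ {p} → Prime p → ∀ a b →
    a * b ≡ 0ℤ [mod + p ] → a ≡ 0ℤ [mod + p ] ⊎ b ≡ 0ℤ [mod + p ]
  euclidsLemma-mod pr a b d
    with euclidsLemma ∣ a ∣ ∣ b ∣ pr (subst (_ ℕD.∣_) (ℤP.abs-* a b) (≡0-mod⇒∣ d))
  ... | inj₁ x = inj₁ (∣⇒≡0-mod x)
  ... | inj₂ y = inj₂ (∣⇒≡0-mod y)

  Unit : ℕ → ℤ → Set
  Unit p a = ¬ a ≡ 0ℤ [mod + p ]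

  unit⇒∤ : ∀ {p a} → Unit p (+ a) → ¬ p ℕD.∣ a
  unit⇒∤ ua p∣a = ua (∣⇒≡0-mod p∣a)

  module _ {p : ℕ} (pr : Prime p) where

    2≤p : 2 ≤ p
    2≤p = ℕ.nonTrivial⇒n>1 p {{prime⇒nonTrivial pr}}

    unit-resp-mod : ∀ {a b} → a ≡ b [mod + p ] → Unit p a → Unit p b
    unit-resp-mod a≡b ua b≡0 = ua (mod-trans a≡b b≡0)

    unit-* : ∀ {a b} → Unit p a → Unit p b → Unit p (a * b)
    unit-* {a} {b} ua ub d with euclidsLemma-mod pr a b d
    ... | inj₁ x = ua x
    ... | inj₂ y = ub y

    unit-1 : Unit p 1ℤ
    unit-1 d = ℕP.<⇒≱ 2≤p (ℕD.∣⇒≤ (≡0-mod⇒∣ d))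

    unit-^ : ∀ {a} → Unit p a → ∀ n → Unit p (a ^ n)
    unit-^ ua zero = unit-1
    unit-^ ua (suc n) = unit-* ua (unit-^ ua n)

    *-cancelʳ-unit-mod : ∀ {a b u} → Unit p u → a * u ≡ b * u [mod + p ] → a ≡ b [mod + p ]
    *-cancelʳ-unit-mod {a} {b} {u} uu au≡bu
      with euclidsLemma-mod pr (a - b) u (subst (_≡ 0ℤ [mod + p ]) (lemma a b u) (mod⇒-≡0-mod au≡bu))
      where lemma : ∀ a b u → a * u - b * u ≡ (a - b) * u
            lemma = solve-∀
    ... | inj₁ a-b≡0 = -≡0-mod⇒mod a-b≡0
    ... | inj₂ u≡0 = ⊥-elim (uu u≡0)

  infixr 8 _^ᶻ_
  _^ᶻ_ : ℕ → ℕ → ℤ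
  p ^ᶻ h = + (p ℕ.^ h)

  ^ᶻ-suc : ∀ p h → p ^ᶻ suc h ≡ p ^ᶻ h * + p
  ^ᶻ-suc p h = trans (ℤP.pos-* p (p ℕ.^ h)) (ℤP.*-comm (+ p) (p ^ᶻ h))

  ^ᶻ-+ : ∀ p a b → p ^ᶻ (a ℕ.+ b) ≡ p ^ᶻ a * p ^ᶻ b
  ^ᶻ-+ p a b = trans (cong +_ (ℕP.^-distribˡ-+-* p a b)) (ℤP.pos-* (p ℕ.^ a) (p ℕ.^ b))

  ^ᶻ-+-≡ : ∀ p {a b c d} → a ℕ.+ b ≡ c ℕ.+ d → p ^ᶻ a * p ^ᶻ b ≡ p ^ᶻ c * p ^ᶻ d
  ^ᶻ-+-≡ p {a} {b} {c} {d} e = trans (sym (^ᶻ-+ p a b)) (trans (cong (p ^ᶻ_) e) (^ᶻ-+ p c d))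

  ^ᶻ-mono-mod : ∀ {p h h′ a b} → h′ ≤ h → a ≡ b [mod p ^ᶻ h ] → a ≡ b [mod p ^ᶻ h′ ]
  ^ᶻ-mono-mod {p} {h} {h′} {a} {b} h′≤h c = mod-*⇒mod {r = p ^ᶻ (h ℕ.∸ h′)} (subst (λ z → a ≡ b [mod z ]) split c)
    where split : p ^ᶻ h ≡ p ^ᶻ h′ * p ^ᶻ (h ℕ.∸ h′)
          split = trans (cong (p ^ᶻ_) (sym (ℕP.m+[n∸m]≡n h′≤h))) (^ᶻ-+ p h′ (h ℕ.∸ h′))

  ^ᶻ-mod⇒mod : ∀ {p h a b} → 1 ≤ h → a ≡ b [mod p ^ᶻ h ] → a ≡ b [mod + p ]
  ^ᶻ-mod⇒mod {p} {a = a} {b} h≥1 a≡b = subst (λ q → a ≡ b [mod q ]) (cong +_ (ℕP.*-identityʳ p)) (^ᶻ-mono-mod h≥1 a≡b)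

  pos-^ : ∀ a n → + (a ℕ.^ n) ≡ (+ a) ^ n
  pos-^ a zero = refl
  pos-^ a (suc n) = trans (ℤP.pos-* a (a ℕ.^ n)) (cong (+ a *_) (pos-^ a n))

  ^-distribʳ-* : ∀ a b n → (a * b) ^ n ≡ a ^ n * b ^ n
  ^-distribʳ-* a b zero = refl
  ^-distribʳ-* a b (suc n) rewrite ^-distribʳ-* a b n = lemma a b (a ^ n) (b ^ n)
    where lemma : ∀ a b x y → a * b * (x * y) ≡ a * x * (b * y)
          lemma = solve-∀

module Binomial where

  open import Data.Nat
  open import Data.Nat.Properties
  open import Data.Nat.Divisibility
  open import Data.Nat.DivMod using (m/n*n≡m)
  open import Data.Nat.Combinatorics using (_C_; nCn≡1; nCk≡n!/k![n-k]!; k![n∸k]!∣n!)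
  open import Data.Nat.Primality using (Prime; euclidsLemma; prime⇒nonTrivial; prime⇒nonZero)
  open import Data.Fin as Fin using (toℕ; fromℕ; inject₁)
  open import Data.Fin.Properties using (toℕ-inject₁; toℕ-fromℕ; toℕ<n)
  open import Data.Vec.Functional using (Vector; tail; init; last)
  open import Data.Product using (∃; _,_)
  open import Data.Sum using (inj₁; inj₂)
  open import Data.Empty using (⊥-elim)
  open import Relation.Nullary using (¬_)
  open import Relation.Binary.PropositionalEquality
  open import Algebra.Properties.CommutativeSemiring.Binomial +-*-commutativeSemiring using (theorem; binomialTerm)
  open import Algebra.Properties.Monoid.Sum +-0-monoid using (sum; sum-init-last)
  import Algebra.Definitions.RawSemiring +-*-rawSemiring as Semiring

  ×≡* : ∀ n x → n Semiring.× x ≡ n * x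
  ×≡* zero x = refl
  ×≡* (suc n) x = cong (x +_) (×≡* n x)

  ^≡^ : ∀ x n → x Semiring.^ n ≡ x ^ n
  ^≡^ x zero = refl
  ^≡^ x (suc n) = cong (x *_) (^≡^ x n)

  ∣-sum : ∀ {d n} (t : Vector ℕ n) → (∀ i → d ∣ t i) → d ∣ sum t
  ∣-sum {d} {zero} t h = d ∣0
  ∣-sum {n = suc n} t h = ∣m∣n⇒∣m+n (h Fin.zero) (∣-sum (λ i → t (Fin.suc i)) (λ i → h (Fin.suc i)))

  n∣n! : ∀ n .{{_ : NonZero n}} → n ∣ n !
  n∣n! (suc n) = m∣m*n (n !)

  module _ {p} (pr : Prime p) where
    p∤j! : ∀ j → j < p → ¬ p ∣ j !
    p∤j! zero j<p p∣1 = <⇒≱ (nonTrivial⇒n>1 p {{prime⇒nonTrivial pr}}) (∣⇒≤ p∣1)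
    p∤j! (suc j) j<p p∣j! with euclidsLemma (suc j) (j !) pr p∣j!
    ... | inj₁ p∣sj = <⇒≱ j<p (∣⇒≤ p∣sj)
    ... | inj₂ p∣j! = p∤j! j (<-trans (n<1+n j) j<p) p∣j!

    p∣pCk : ∀ k → 0 < k → k < p → p ∣ p C k
    p∣pCk k 0<k k<p with euclidsLemma (p C k) (k ! * (p ∸ k) !) pr p∣product
      where
      instance _ = k !* (p ∸ k) !≢0
      p∣product : p ∣ (p C k) * (k ! * (p ∸ k) !)
      p∣product = subst (p ∣_) (sym (trans (cong (_* (k ! * (p ∸ k) !)) (nCk≡n!/k![n-k]! (<⇒≤ k<p)))
                                            (m/n*n≡m (k![n∸k]!∣n! (<⇒≤ k<p)))))
                    (n∣n! p {{prime⇒nonZero pr}})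
    ... | inj₁ p∣C = p∣C
    ... | inj₂ p∣k!r! with euclidsLemma (k !) ((p ∸ k) !) pr p∣k!r!
    ...   | inj₁ p∣k! = ⊥-elim (p∤j! k k<p p∣k!)
    ...   | inj₂ p∣r! = ⊥-elim (p∤j! (p ∸ k) (∸-monoʳ-< 0<k (<⇒≤ k<p)) p∣r!)

  binomialTerm-zero : ∀ x n → binomialTerm x 1 n Fin.zero ≡ 1
  binomialTerm-zero x n = begin
    1 Semiring.× (1 * 1 Semiring.^ n) ≡⟨ ×≡* 1 _ ⟩
    1 * (1 * 1 Semiring.^ n)          ≡⟨ *-identityˡ _ ⟩
    1 * 1 Semiring.^ n                ≡⟨ *-identityˡ _ ⟩
    1 Semiring.^ n                    ≡⟨ ^≡^ 1 n ⟩
    1 ^ n                             ≡⟨ ^-zeroˡ n ⟩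
    1                                 ∎
    where open ≡-Reasoning

  binomialTerm-last : ∀ x n → binomialTerm x 1 n (fromℕ n) ≡ x ^ n
  binomialTerm-last x n = begin
    (n C toℕ (fromℕ n)) Semiring.× (x Semiring.^ toℕ (fromℕ n) * 1 Semiring.^ (n ∸ toℕ (fromℕ n)))
      ≡⟨ cong (λ j → (n C j) Semiring.× (x Semiring.^ j * 1 Semiring.^ (n ∸ j))) (toℕ-fromℕ n) ⟩
    (n C n) Semiring.× (x Semiring.^ n * 1 Semiring.^ (n ∸ n))
      ≡⟨ cong₂ (λ c j → c Semiring.× (x Semiring.^ n * 1 Semiring.^ j)) (nCn≡1 n) (n∸n≡0 n) ⟩
    1 Semiring.× (x Semiring.^ n * 1) ≡⟨ ×≡* 1 _ ⟩
    1 * (x Semiring.^ n * 1)          ≡⟨ *-identityˡ _ ⟩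
    x Semiring.^ n * 1                ≡⟨ *-identityʳ _ ⟩
    x Semiring.^ n                    ≡⟨ ^≡^ x n ⟩
    x ^ n                             ∎
    where open ≡-Reasoning

  p∣binomialTerm : ∀ {p} → Prime p → ∀ x k → 0 < toℕ k → toℕ k < p → p ∣ binomialTerm x 1 p k
  p∣binomialTerm {p} pr x k 0<k k<p =
    ∣-trans (p∣pCk pr (toℕ k) 0<k k<p) (subst (p C toℕ k ∣_) (sym (×≡* (p C toℕ k) rest)) (m∣m*n rest))
    where rest = x Semiring.^ toℕ k * 1 Semiring.^ (p ∸ toℕ k)

  -- In the binomial expansion of (x + 1)^p every coefficient but the outer two is a multiple of p.
  frobenius : ∀ {p} → Prime p → ∀ x → ∃ λ K → (1 + x) ^ p ≡ 1 + x ^ p + K * p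
  frobenius {zero} pr x with () ← prime⇒nonZero pr
  frobenius {suc q} pr x = quotient p∣inner , (begin
    (1 + x) ^ p                                      ≡⟨ cong (_^ p) (+-comm 1 x) ⟩
    (x + 1) ^ p                                      ≡⟨ ^≡^ (x + 1) p ⟨
    (x + 1) Semiring.^ p                             ≡⟨ theorem p x 1 ⟩
    term Fin.zero + sum (tail term)                  ≡⟨ cong (term Fin.zero +_) (sum-init-last (tail term)) ⟩
    term Fin.zero + (sum inner + last (tail term))   ≡⟨ cong₂ (λ u v → u + (sum inner + v)) (binomialTerm-zero x p) (binomialTerm-last x p) ⟩
    1 + (sum inner + x ^ p)                          ≡⟨ cong (λ u → 1 + (u + x ^ p)) (m∣n⇒n≡quotient*m p∣inner) ⟩
    1 + (quotient p∣inner * p + x ^ p)               ≡⟨ cong (1 +_) (+-comm _ (x ^ p)) ⟩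
    1 + (x ^ p + quotient p∣inner * p)               ≡⟨ +-assoc 1 (x ^ p) _ ⟨
    1 + x ^ p + quotient p∣inner * p                 ∎)
    where
    open ≡-Reasoning
    p = suc q
    term = binomialTerm x 1 p
    inner = init (tail term)
    p∣inner : p ∣ sum inner
    p∣inner = ∣-sum inner λ i → p∣binomialTerm pr x (Fin.suc (inject₁ i)) z<s
      (s<s (subst (_< q) (sym (toℕ-inject₁ i)) (toℕ<n i)))

module Fermat where

  open import Data.Nat as ℕ using (ℕ; zero; suc)
  import Data.Nat.Properties as ℕP
  open import Data.Nat.Primality using (Prime; prime⇒nonZero)
  open import Data.Nat.Tactic.RingSolver as ℕSolver using ()
  open import Data.Integer as ℤ using (ℤ; +_; -_; _+_; _*_; _-_; 0ℤ; 1ℤ; _^_)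
  import Data.Integer.Properties as ℤP
  open import Data.Integer.Tactic.RingSolver using (solve-∀)
  open import Data.Product using (Σ; ∃; _,_; proj₁; proj₂)
  open import Data.Sum using (inj₁; inj₂)
  open import Data.Empty using (⊥-elim)
  open import Relation.Binary.PropositionalEquality
  open Congruence
  import Relation.Binary.Reasoning.Setoid as SetoidReasoning
  open Binomial using (frobenius)

  0^n≡0 : ∀ n .{{_ : ℕ.NonZero n}} → 0 ℕ.^ n ≡ 0
  0^n≡0 (suc n) = refl

  module _ {p : ℕ} (pr : Prime p) where

    fermat-ℕ : ∀ x → ∃ λ K → x ℕ.^ p ≡ x ℕ.+ K ℕ.* p
    fermat-ℕ zero = 0 , 0^n≡0 p {{prime⇒nonZero pr}}
    fermat-ℕ (suc x) with frobenius pr x | fermat-ℕ x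
    ... | K , frob | K′ , ih = K′ ℕ.+ K , (begin
      suc x ℕ.^ p                             ≡⟨ frob ⟩
      1 ℕ.+ x ℕ.^ p ℕ.+ K ℕ.* p                ≡⟨ cong (λ z → 1 ℕ.+ z ℕ.+ K ℕ.* p) ih ⟩
      1 ℕ.+ (x ℕ.+ K′ ℕ.* p) ℕ.+ K ℕ.* p       ≡⟨ lemma x K K′ p ⟩
      suc x ℕ.+ (K′ ℕ.+ K) ℕ.* p               ∎)
      where
      open ≡-Reasoning
      lemma : ∀ x K K′ p → 1 ℕ.+ (x ℕ.+ K′ ℕ.* p) ℕ.+ K ℕ.* p ≡ suc x ℕ.+ (K′ ℕ.+ K) ℕ.* p
      lemma = ℕSolver.solve-∀

    private instance
      p≢0 : ℕ.NonZero p
      p≢0 = prime⇒nonZero pr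

    fermat-mod : ∀ a → a ^ p ≡ a [mod + p ]
    fermat-mod a = begin
      a ^ p                 ≈⟨ ^-cong-mod (≡-mod-% a) p ⟩
      (+ r) ^ p             ≡⟨ pos-^ r p ⟨
      + (r ℕ.^ p)           ≡⟨ cong +_ (proj₂ (fermat-ℕ r)) ⟩
      + (r ℕ.+ K ℕ.* p)     ≡⟨ trans (ℤP.pos-+ r (K ℕ.* p)) (cong (λ z → + r + z) (ℤP.pos-* K p)) ⟩
      + r + + K * + p       ≈⟨ +-multiple-mod (+ r) (+ K) ⟩
      + r                   ≈⟨ mod-sym (≡-mod-% a) ⟩
      a                     ∎
      where
      open SetoidReasoning (mod-setoid (+ p))
      r = a ℤ.% + p
      K = proj₁ (fermat-ℕ r)

    fermat-little : ∀ {a} → Unit p a → a ^ (p ℕ.∸ 1) ≡ 1ℤ [mod + p ]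
    fermat-little {a} ua with euclidsLemma-mod pr a (a ^ (p ℕ.∸ 1) - 1ℤ) (subst (_≡ 0ℤ [mod + p ]) factor (mod⇒-≡0-mod (fermat-mod a)))
      where
      factor : a ^ p - a ≡ a * (a ^ (p ℕ.∸ 1) - 1ℤ)
      factor = trans (cong (λ n → a ^ n - a) (sym (ℕP.m+[n∸m]≡n {1} {p} (ℕP.<⇒≤ (2≤p pr))))) (lemma a (a ^ (p ℕ.∸ 1)))
        where lemma : ∀ a b → a * b - a ≡ a * (b - 1ℤ)
              lemma = solve-∀
    ... | inj₁ a≡0 = ⊥-elim (ua a≡0)
    ... | inj₂ a^[p-1]-1≡0 = -≡0-mod⇒mod a^[p-1]-1≡0

    inverse-mod : ∀ {a} → Unit p a → ∀ h → Σ ℤ λ b → a * b ≡ 1ℤ [mod p ^ᶻ h ]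
    inverse-mod {a} ua zero = 0ℤ , (a * 0ℤ - 1ℤ) , lemma a
      where lemma : ∀ a → a * 0ℤ ≡ 1ℤ + (a * 0ℤ - 1ℤ) * 1ℤ
            lemma = solve-∀
    inverse-mod {a} ua (suc zero) = a ^ (p ℕ.∸ 2) , (begin
      a * a ^ (p ℕ.∸ 2)  ≡⟨ cong (a ^_) (ℕP.+-∸-assoc 1 {p} {2} (2≤p pr)) ⟨
      a ^ (p ℕ.∸ 1)      ≈⟨ subst (λ q → a ^ (p ℕ.∸ 1) ≡ 1ℤ [mod q ]) (cong +_ (sym (ℕP.*-identityʳ p))) (fermat-little ua) ⟩
      1ℤ                 ∎)
      where open SetoidReasoning (mod-setoid (p ^ᶻ 1))
    -- Newton's iteration b ↦ b (2 − a b): its error 1 − a b (2 − a b) = (a b − 1)² is squared.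
    inverse-mod {a} ua (suc (suc h)) with inverse-mod ua (suc h)
    ... | b , (c , ab≡1+cq) = b * (+ 2 - a * b) , - (c * c * p ^ᶻ h) , (begin
      a * (b * (+ 2 - a * b))                      ≡⟨ lemma₁ a b ⟩
      1ℤ - (a * b - 1ℤ) * (a * b - 1ℤ)             ≡⟨ cong (λ z → 1ℤ - (z - 1ℤ) * (z - 1ℤ)) ab≡1+cq ⟩
      1ℤ - (1ℤ + c * q - 1ℤ) * (1ℤ + c * q - 1ℤ)   ≡⟨ lemma₂ c q ⟩
      1ℤ - c * c * (q * q)                         ≡⟨ cong (λ z → 1ℤ - c * c * z) q²≡ ⟩
      1ℤ - c * c * (p ^ᶻ suc (suc h) * p ^ᶻ h)     ≡⟨ lemma₃ c (p ^ᶻ suc (suc h)) (p ^ᶻ h) ⟩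
      1ℤ + - (c * c * p ^ᶻ h) * p ^ᶻ suc (suc h)   ∎)
      where
      open ≡-Reasoning
      q = p ^ᶻ suc h
      q²≡ : q * q ≡ p ^ᶻ suc (suc h) * p ^ᶻ h
      q²≡ = trans (sym (^ᶻ-+ p (suc h) (suc h))) (trans (cong (λ n → p ^ᶻ suc n) (ℕP.+-suc h h)) (^ᶻ-+ p (suc (suc h)) h))
      lemma₁ : ∀ a b → a * (b * (+ 2 - a * b)) ≡ 1ℤ - (a * b - 1ℤ) * (a * b - 1ℤ)
      lemma₁ = solve-∀
      lemma₂ : ∀ c q → 1ℤ - (1ℤ + c * q - 1ℤ) * (1ℤ + c * q - 1ℤ) ≡ 1ℤ - c * c * (q * q)
      lemma₂ = solve-∀
      lemma₃ : ∀ c Q R → 1ℤ - c * c * (Q * R) ≡ 1ℤ + - (c * c * R) * Q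
      lemma₃ = solve-∀

    unit-cancel-mod : ∀ {a} → Unit p a → ∀ h {x} → a * x ≡ 0ℤ [mod p ^ᶻ h ] → x ≡ 0ℤ [mod p ^ᶻ h ]
    unit-cancel-mod {a} ua h {x} ax≡0 with inverse-mod ua h
    ... | b , ab≡1 = begin
      x            ≡⟨ ℤP.*-identityˡ x ⟨
      1ℤ * x       ≈⟨ *-cong-mod (mod-sym ab≡1) mod-refl ⟩
      a * b * x    ≡⟨ lemma a b x ⟩
      b * (a * x)  ≈⟨ *-cong-mod (mod-refl {a = b}) ax≡0 ⟩
      b * 0ℤ       ≡⟨ ℤP.*-zeroʳ b ⟩
      0ℤ           ∎
      where
      open SetoidReasoning (mod-setoid (p ^ᶻ h))
      lemma : ∀ a b x → a * b * x ≡ b * (a * x)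
      lemma = solve-∀

module Hensel where

  open import Data.Nat as ℕ using (ℕ; zero; suc; _≤_; _<_; z≤n; s≤s)
  import Data.Nat.Properties as ℕP
  open import Data.Nat.Divisibility as ℕD using (divides)
  open import Data.Nat.Combinatorics using (_C_; nC1≡n; nCk+nC[k+1]≡[n+1]C[k+1])
  open import Data.Nat.Primality using (Prime)
  open import Data.Nat.Tactic.RingSolver as ℕSolver using ()
  open import Data.Integer as ℤ using (ℤ; +_; -_; _+_; _*_; _-_; 0ℤ; 1ℤ; _^_)
  import Data.Integer.Properties as ℤP
  open import Data.Integer.Tactic.RingSolver using (solve-∀)
  open import Data.Product using (Σ; ∃; _,_; _×_)
  open import Relation.Nullary using (yes; no)
  open import Relation.Binary.PropositionalEquality
  open Congruence
  import Relation.Binary.Reasoning.Setoid as SetoidReasoning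
  open Binomial using (p∣pCk)
  open Fermat using (inverse-mod)

  binomial-cubic : ∀ X n → Σ ℤ λ Q → (1ℤ + X) ^ n ≡ 1ℤ + + n * X + + (n C 2) * X * X + Q * X * X * X
  binomial-cubic X zero = 0ℤ , lemma X
    where lemma : ∀ X → 1ℤ ≡ 1ℤ + 0ℤ * X + 0ℤ * X * X + 0ℤ * X * X * X
          lemma = solve-∀
  binomial-cubic X (suc n) with binomial-cubic X n
  ... | Q , eq = + (n C 2) + Q + Q * X , (begin
    (1ℤ + X) * (1ℤ + X) ^ n                                       ≡⟨ cong ((1ℤ + X) *_) eq ⟩
    (1ℤ + X) * (1ℤ + + n * X + + (n C 2) * X * X + Q * X * X * X)  ≡⟨ lemma X (+ n) (+ (n C 2)) Q ⟩
    1ℤ + (1ℤ + + n) * X + (+ (n C 2) + + n) * X * X + Q′ * X * X * X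
      ≡⟨ cong₂ (λ u v → 1ℤ + u * X + v * X * X + Q′ * X * X * X) (sym (ℤP.pos-+ 1 n)) (cong +_ pascal) ⟩
    1ℤ + + suc n * X + + (suc n C 2) * X * X + Q′ * X * X * X      ∎)
    where
    open ≡-Reasoning
    Q′ = + (n C 2) + Q + Q * X
    pascal : n C 2 ℕ.+ n ≡ suc n C 2
    pascal = trans (ℕP.+-comm (n C 2) n) (trans (cong (ℕ._+ n C 2) (sym (nC1≡n n))) (nCk+nC[k+1]≡[n+1]C[k+1] n 1))
    lemma : ∀ X n T Q → (1ℤ + X) * (1ℤ + n * X + T * X * X + Q * X * X * X) ≡
            1ℤ + (1ℤ + n) * X + (T + n) * X * X + (T + Q + Q * X) * X * X * X
    lemma = solve-∀

  binomial-linear-mod : ∀ {q P} → P * P ≡ 0ℤ [mod q ] → ∀ Y m → (1ℤ + P * Y) ^ m ≡ 1ℤ + + m * (P * Y) [mod q ]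
  binomial-linear-mod {q} {P} P²≡0 Y m = let T , expand = binomial-cubic (P * Y) m in begin
    (1ℤ + P * Y) ^ m                                                      ≡⟨ expand ⟩
    1ℤ + + m * (P * Y) + + (m C 2) * (P * Y) * (P * Y) + T * (P * Y) * (P * Y) * (P * Y)
                                                                          ≡⟨ regroup (+ m) (+ (m C 2)) T P Y ⟩
    1ℤ + + m * (P * Y) + P * P * (+ (m C 2) * Y * Y + T * P * Y * Y * Y)  ≈⟨ +-cong-mod (mod-refl {a = 1ℤ + + m * (P * Y)}) (*-cong-mod P²≡0 mod-refl) ⟩
    1ℤ + + m * (P * Y) + 0ℤ                                               ≡⟨ ℤP.+-identityʳ _ ⟩
    1ℤ + + m * (P * Y)                                                    ∎
    where
    open SetoidReasoning (mod-setoid q)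
    regroup : ∀ m c T P Y → 1ℤ + m * (P * Y) + c * (P * Y) * (P * Y) + T * (P * Y) * (P * Y) * (P * Y) ≡
                            1ℤ + m * (P * Y) + P * P * (c * Y * Y + T * P * Y * Y * Y)
    regroup = solve-∀

  <⇒∃suc+≡ : ∀ {τ h} → τ < h → ∃ λ j → suc j ℕ.+ τ ≡ h
  <⇒∃suc+≡ {τ} {h} τ<h = h ℕ.∸ suc τ , trans (sym (ℕP.+-suc (h ℕ.∸ suc τ) τ)) (ℕP.m∸n+n≡m τ<h)

  module _ {p : ℕ} (pr : Prime p) where

    -- p divides p C 2 unless p = 2, and then i ≥ 1 provides the missing factor.
    quadratic-term-divisible : ∀ i → (p ≡ 2 → 2 ≤ suc i) →
      Σ ℤ λ E → + (p C 2) * (p ^ᶻ suc i * p ^ᶻ suc i) ≡ p ^ᶻ (3 ℕ.+ i) * E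
    quadratic-term-divisible i i≥2 with p ℕ.≟ 2
    ... | yes refl with i≥2 refl
    ...   | s≤s (s≤s {n = i′} _) = 2 ^ᶻ i′ , (begin
      + 1 * (2 ^ᶻ suc i * 2 ^ᶻ suc i)   ≡⟨ ℤP.*-identityˡ _ ⟩
      2 ^ᶻ suc i * 2 ^ᶻ suc i           ≡⟨ ^ᶻ-+-≡ 2 {suc i} {suc i} {3 ℕ.+ i} {i′} (exponents i′) ⟩
      2 ^ᶻ (3 ℕ.+ i) * 2 ^ᶻ i′          ∎)
      where
      open ≡-Reasoning
      exponents : ∀ i′ → suc (suc i′) ℕ.+ suc (suc i′) ≡ 3 ℕ.+ suc i′ ℕ.+ i′
      exponents = ℕSolver.solve-∀
    quadratic-term-divisible i _ | no p≢2 with p∣pCk pr 2 (s≤s z≤n) (ℕP.≤∧≢⇒< (2≤p pr) (λ 2≡p → p≢2 (sym 2≡p)))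
    ... | divides t pC2≡tp = + t * p ^ᶻ i , (begin
      + (p C 2) * (q * q)               ≡⟨ cong (λ z → + z * (q * q)) pC2≡tp ⟩
      + (t ℕ.* p) * (q * q)             ≡⟨ cong (_* (q * q)) (ℤP.pos-* t p) ⟩
      + t * + p * (q * q)               ≡⟨ lemma (+ t) (+ p) q ⟩
      + t * (q * + p * q)               ≡⟨ cong (λ z → + t * (z * q)) (^ᶻ-suc p (suc i)) ⟨
      + t * (p ^ᶻ suc (suc i) * q)      ≡⟨ cong (λ z → + t * z) (^ᶻ-+-≡ p {suc (suc i)} {suc i} {3 ℕ.+ i} {i} (exponents i)) ⟩
      + t * (p ^ᶻ (3 ℕ.+ i) * p ^ᶻ i)   ≡⟨ lemma′ (+ t) (p ^ᶻ (3 ℕ.+ i)) (p ^ᶻ i) ⟩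
      p ^ᶻ (3 ℕ.+ i) * (+ t * p ^ᶻ i)   ∎)
      where
      open ≡-Reasoning
      q = p ^ᶻ suc i
      exponents : ∀ i → suc (suc i) ℕ.+ suc i ≡ 3 ℕ.+ i ℕ.+ i
      exponents = ℕSolver.solve-∀
      lemma : ∀ t p q → t * p * (q * q) ≡ t * (q * p * q)
      lemma = solve-∀
      lemma′ : ∀ t A B → t * (A * B) ≡ A * (t * B)
      lemma′ = solve-∀

    ^p-raises-order : ∀ i → (p ≡ 2 → 2 ≤ suc i) → ∀ Y →
      Σ ℤ λ c → (1ℤ + p ^ᶻ suc i * Y) ^ p ≡ 1ℤ + p ^ᶻ suc (suc i) * (Y + + p * c)
    ^p-raises-order i i≥2 Y with binomial-cubic (p ^ᶻ suc i * Y) p | quadratic-term-divisible i i≥2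
    ... | Q , expand | E , quadratic≡ = E * Y * Y + Q * p ^ᶻ (i ℕ.+ i) * Y * Y * Y , (begin
      (1ℤ + X) ^ p                                                       ≡⟨ expand ⟩
      1ℤ + + p * X + + (p C 2) * X * X + Q * X * X * X                    ≡⟨ lemma₁ (+ p) (+ (p C 2)) Q P₁ Y ⟩
      1ℤ + + p * X + + (p C 2) * (P₁ * P₁) * Y * Y + Q * (P₁ * P₁ * P₁) * Y * Y * Y
        ≡⟨ cong₂ (λ u v → 1ℤ + + p * X + u * Y * Y + Q * v * Y * Y * Y) quadratic≡ cubic≡ ⟩
      1ℤ + + p * X + P₃ * E * Y * Y + Q * (P₃ * p ^ᶻ (i ℕ.+ i)) * Y * Y * Y
        ≡⟨ cong₂ (λ u v → 1ℤ + u + v * E * Y * Y + Q * (v * p ^ᶻ (i ℕ.+ i)) * Y * Y * Y) linear≡ (^ᶻ-suc p (suc (suc i))) ⟩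
      1ℤ + P₂ * Y + P₂ * + p * E * Y * Y + Q * (P₂ * + p * p ^ᶻ (i ℕ.+ i)) * Y * Y * Y
        ≡⟨ lemma₂ P₂ Y (+ p) E Q (p ^ᶻ (i ℕ.+ i)) ⟩
      1ℤ + P₂ * (Y + + p * (E * Y * Y + Q * p ^ᶻ (i ℕ.+ i) * Y * Y * Y)) ∎)
      where
      open ≡-Reasoning
      P₁ = p ^ᶻ suc i
      P₂ = p ^ᶻ suc (suc i)
      P₃ = p ^ᶻ (3 ℕ.+ i)
      X = P₁ * Y
      linear≡ : + p * X ≡ P₂ * Y
      linear≡ = trans (sym (ℤP.*-assoc (+ p) P₁ Y)) (cong (_* Y) (trans (ℤP.*-comm (+ p) P₁) (sym (^ᶻ-suc p (suc i)))))
      cubic≡ : P₁ * P₁ * P₁ ≡ P₃ * p ^ᶻ (i ℕ.+ i)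
      cubic≡ = trans (cong (_* P₁) (sym (^ᶻ-+ p (suc i) (suc i))))
                     (^ᶻ-+-≡ p {suc i ℕ.+ suc i} {suc i} {3 ℕ.+ i} {i ℕ.+ i} (exponents i))
        where exponents : ∀ i → suc i ℕ.+ suc i ℕ.+ suc i ≡ 3 ℕ.+ i ℕ.+ (i ℕ.+ i)
              exponents = ℕSolver.solve-∀
      lemma₁ : ∀ p T Q P Y → 1ℤ + p * (P * Y) + T * (P * Y) * (P * Y) + Q * (P * Y) * (P * Y) * (P * Y) ≡
               1ℤ + p * (P * Y) + T * (P * P) * Y * Y + Q * (P * P * P) * Y * Y * Y
      lemma₁ = solve-∀
      lemma₂ : ∀ P Y p E Q R → 1ℤ + P * Y + P * p * E * Y * Y + Q * (P * p * R) * Y * Y * Y ≡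
               1ℤ + P * (Y + p * (E * Y * Y + Q * R * Y * Y * Y))
      lemma₂ = solve-∀

    ^p^τ-raises-order : ∀ τ j → (p ≡ 2 → 1 ≤ τ → 2 ≤ suc j) → ∀ y →
      Σ ℤ λ c → (1ℤ + p ^ᶻ suc j * y) ^ (p ℕ.^ τ) ≡ 1ℤ + p ^ᶻ (suc j ℕ.+ τ) * (y + + p * c)
    ^p^τ-raises-order zero j _ y = 0ℤ , (begin
      (1ℤ + p ^ᶻ suc j * y) * 1ℤ            ≡⟨ lemma (p ^ᶻ suc j) y (+ p) ⟩
      1ℤ + p ^ᶻ suc j * (y + + p * 0ℤ)      ≡⟨ cong (λ n → 1ℤ + p ^ᶻ n * (y + + p * 0ℤ)) (ℕP.+-identityʳ (suc j)) ⟨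
      1ℤ + p ^ᶻ (suc j ℕ.+ 0) * (y + + p * 0ℤ) ∎)
      where
      open ≡-Reasoning
      lemma : ∀ P y p → (1ℤ + P * y) * 1ℤ ≡ 1ℤ + P * (y + p * 0ℤ)
      lemma = solve-∀
    ^p^τ-raises-order (suc τ) j j≥1 y =
      let c  , eqτ = ^p^τ-raises-order τ j (λ p≡2 _ → j≥1 p≡2 (s≤s z≤n)) y
          c′ , eqp = ^p-raises-order (j ℕ.+ τ) (λ p≡2 → ℕP.≤-trans (j≥1 p≡2 (s≤s z≤n)) (s≤s (ℕP.m≤m+n j τ))) (y + + p * c)
      in c + c′ , (begin
      V ^ (p ℕ.* p ℕ.^ τ)                             ≡⟨ cong (V ^_) (ℕP.*-comm p (p ℕ.^ τ)) ⟩
      V ^ (p ℕ.^ τ ℕ.* p)                             ≡⟨ ℤP.^-*-assoc V (p ℕ.^ τ) p ⟨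
      (V ^ (p ℕ.^ τ)) ^ p                             ≡⟨ cong (_^ p) eqτ ⟩
      (1ℤ + p ^ᶻ (suc j ℕ.+ τ) * (y + + p * c)) ^ p   ≡⟨ eqp ⟩
      1ℤ + p ^ᶻ suc (suc j ℕ.+ τ) * (y + + p * c + + p * c′)
        ≡⟨ cong (λ n → 1ℤ + p ^ᶻ n * (y + + p * c + + p * c′)) (ℕP.+-suc (suc j) τ) ⟨
      1ℤ + p ^ᶻ (suc j ℕ.+ suc τ) * (y + + p * c + + p * c′) ≡⟨ lemma (p ^ᶻ (suc j ℕ.+ suc τ)) y (+ p) c c′ ⟩
      1ℤ + p ^ᶻ (suc j ℕ.+ suc τ) * (y + + p * (c + c′)) ∎)
      where
      open ≡-Reasoning
      V = 1ℤ + p ^ᶻ suc j * y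
      lemma : ∀ P y p c c′ → 1ℤ + P * (y + p * c + p * c′) ≡ 1ℤ + P * (y + p * (c + c′))
      lemma = solve-∀

    correction-power : ∀ τ m j → (p ≡ 2 → 1 ≤ τ → 2 ≤ suc j) → ∀ y →
      (1ℤ + p ^ᶻ suc j * y) ^ (p ℕ.^ τ ℕ.* m) ≡ 1ℤ + + m * (p ^ᶻ (suc j ℕ.+ τ) * y) [mod p ^ᶻ (suc j ℕ.+ τ) * + p ]
    correction-power τ m j j≥2 y = from (^p^τ-raises-order τ j j≥2 y)
      where
      open SetoidReasoning (mod-setoid (p ^ᶻ (suc j ℕ.+ τ) * + p))
      P = p ^ᶻ (suc j ℕ.+ τ)
      v = 1ℤ + p ^ᶻ suc j * y
      P²≡0 : P * P ≡ 0ℤ [mod P * + p ]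
      P²≡0 = p ^ᶻ (j ℕ.+ τ) , trans (cong (P *_) (ℤP.pos-* p (p ℕ.^ (j ℕ.+ τ)))) (lemma P (+ p) (p ^ᶻ (j ℕ.+ τ)))
        where lemma : ∀ P p R → P * (p * R) ≡ 0ℤ + R * (P * p)
              lemma = solve-∀
      from : Σ ℤ (λ c → v ^ (p ℕ.^ τ) ≡ 1ℤ + P * (y + + p * c)) →
             v ^ (p ℕ.^ τ ℕ.* m) ≡ 1ℤ + + m * (P * y) [mod P * + p ]
      from (c , eqτ) = begin
        v ^ (p ℕ.^ τ ℕ.* m)                ≡⟨ ℤP.^-*-assoc v (p ℕ.^ τ) m ⟨
        (v ^ (p ℕ.^ τ)) ^ m                ≡⟨ cong (_^ m) eqτ ⟩
        (1ℤ + P * (y + + p * c)) ^ m       ≈⟨ binomial-linear-mod {P = P} P²≡0 (y + + p * c) m ⟩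
        1ℤ + + m * (P * (y + + p * c))     ≡⟨ lemma (+ m) P y (+ p) c ⟩
        1ℤ + + m * (P * y) + + m * c * (P * + p) ≈⟨ +-multiple-mod _ (+ m * c) ⟩
        1ℤ + + m * (P * y)                 ∎
        where lemma : ∀ m P y p c → 1ℤ + m * (P * (y + p * c)) ≡ 1ℤ + m * (P * y) + m * c * (P * p)
              lemma = solve-∀

    -- Hensel's step: w^k + z p^h is again a k-th power w′^k mod p^(h+1), with w′ = w (1 + p^(j+1) z b)
    -- for b an inverse of m w^k modulo p.
    lift-kth-power : ∀ τ m → Unit p (+ m) → ∀ j → (p ≡ 2 → 1 ≤ τ → 2 ≤ suc j) →
      ∀ {w c} → Unit p w → c ≡ w ^ (p ℕ.^ τ ℕ.* m) [mod p ^ᶻ (suc j ℕ.+ τ) ] →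
      Σ ℤ λ w′ → Unit p w′ × c ≡ w′ ^ (p ℕ.^ τ ℕ.* m) [mod p ^ᶻ suc (suc j ℕ.+ τ) ]
    lift-kth-power τ m um j j≥2 {w} {c} uw (z , c≡W+zP) =
      from (inverse-mod pr (unit-* pr (unit-^ pr uw k) um) 1)
      where
      k = p ℕ.^ τ ℕ.* m
      W = w ^ k
      P = p ^ᶻ (suc j ℕ.+ τ)
      from : Σ ℤ (λ b → W * + m * b ≡ 1ℤ [mod p ^ᶻ 1 ]) →
             Σ ℤ λ w′ → Unit p w′ × c ≡ w′ ^ k [mod p ^ᶻ suc (suc j ℕ.+ τ) ]
      from (b , (e , Wmb≡1+ep)) =
        w * v , unit-* pr uw unit-v , subst (λ q → c ≡ (w * v) ^ k [mod q ]) (sym (^ᶻ-suc p (suc j ℕ.+ τ))) (begin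
          c                                  ≡⟨ c≡W+zP ⟩
          W + z * P                          ≈⟨ mod-sym (+-multiple-mod (W + z * P) (z * e)) ⟩
          W + z * P + z * e * (P * + p)      ≡⟨ lemma₁ W z P e (+ p) ⟩
          W + z * P * (1ℤ + e * + p)         ≡⟨ cong (λ u → W + z * P * u) Wmb≡1+ep′ ⟨
          W + z * P * (W * + m * b)          ≡⟨ lemma₂ W z P (+ m) b ⟩
          W * (1ℤ + + m * (P * (z * b)))     ≈⟨ *-cong-mod (mod-refl {a = W}) (mod-sym (correction-power τ m j j≥2 (z * b))) ⟩
          W * v ^ k                          ≡⟨ ^-distribʳ-* w v k ⟨
          (w * v) ^ k                        ∎)
        where
        open SetoidReasoning (mod-setoid (P * + p))
        v = 1ℤ + p ^ᶻ suc j * (z * b)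
        lemma₁ : ∀ W z P e p → W + z * P + z * e * (P * p) ≡ W + z * P * (1ℤ + e * p)
        lemma₁ = solve-∀
        lemma₂ : ∀ W z P m b → W + z * P * (W * m * b) ≡ W * (1ℤ + m * (P * (z * b)))
        lemma₂ = solve-∀
        lemma₃ : ∀ R p y → 1ℤ + R * p * y ≡ 1ℤ + R * y * p
        lemma₃ = solve-∀
        Wmb≡1+ep′ : W * + m * b ≡ 1ℤ + e * + p
        Wmb≡1+ep′ = trans Wmb≡1+ep (cong (λ u → 1ℤ + e * + u) (ℕP.*-identityʳ p))
        v≡1 : v ≡ 1ℤ [mod + p ]
        v≡1 = p ^ᶻ j * (z * b) , trans (cong (λ u → 1ℤ + u * (z * b)) (^ᶻ-suc p j)) (lemma₃ (p ^ᶻ j) (+ p) (z * b))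
        unit-v : Unit p v
        unit-v = unit-resp-mod pr (mod-sym v≡1) (unit-1 pr)

    lift-kth-power-≥ : ∀ τ m → Unit p (+ m) → ∀ h → suc τ ≤ h → (p ≡ 2 → 1 ≤ τ → 2 ℕ.+ τ ≤ h) →
      ∀ {w c} → Unit p w → c ≡ w ^ (p ℕ.^ τ ℕ.* m) [mod p ^ᶻ h ] →
      Σ ℤ λ w′ → Unit p w′ × c ≡ w′ ^ (p ℕ.^ τ ℕ.* m) [mod p ^ᶻ suc h ]
    lift-kth-power-≥ τ m um h τ<h h≥τ+2 uw c≡w^k with j , refl ← <⇒∃suc+≡ τ<h =
      lift-kth-power τ m um j (λ p≡2 τ≥1 → ℕP.+-cancelʳ-≤ τ 2 (suc j) (h≥τ+2 p≡2 τ≥1)) uw c≡w^k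

module Counting where

  open import Data.Nat using (ℕ; zero; suc; _+_; _*_; _∸_; _≤_; _<_; z≤n; s≤s; _≟_; _<?_)
  open import Data.Nat.Properties
  open import Data.Nat.Tactic.RingSolver using (solve-∀)
  open import Data.Bool using (Bool; true; false; _∧_; _∨_; not; if_then_else_)
  open import Data.Bool.Properties using (∧-identityʳ; ∧-zeroʳ; ∨-zeroʳ)
  open import Data.Product using (Σ; _,_; _×_; proj₁; proj₂)
  open import Data.Empty using (⊥-elim)
  open import Relation.Nullary using (¬_; Dec; yes; no; does)
  open import Relation.Nullary.Decidable using (dec-true; dec-false)
  open import Relation.Binary.PropositionalEquality
  open import Relation.Binary using (tri<; tri≈; tri>)
  open import Function using (_∘_)

  does≡true⇒ : ∀ {a} {A : Set a} (a? : Dec A) → does a? ≡ true → A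
  does≡true⇒ (yes a) _ = a

  not-does⇒¬ : ∀ {a} {A : Set a} (a? : Dec A) → not (does a?) ≡ true → ¬ A
  not-does⇒¬ (no ¬a) _ = ¬a

  true≢false : true ≢ false
  true≢false ()

  not≡true⇒≡false : ∀ {b} → not b ≡ true → b ≡ false
  not≡true⇒≡false {false} _ = refl

  ∧≡true : ∀ {a b} → a ∧ b ≡ true → a ≡ true × b ≡ true
  ∧≡true {true} {true} _ = refl , refl

  sumBelow : ℕ → (ℕ → ℕ) → ℕ
  sumBelow zero f = 0
  sumBelow (suc m) f = sumBelow m f + f m

  infix 10 sumBelow
  syntax sumBelow m (λ i → e) = ∑[ i < m ] e

  ∑-distrib-+ : ∀ m (f g : ℕ → ℕ) → ∑[ i < m ] (f i + g i) ≡ ∑[ i < m ] f i + ∑[ i < m ] g i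
  ∑-distrib-+ zero f g = refl
  ∑-distrib-+ (suc m) f g rewrite ∑-distrib-+ m f g = lemma (sumBelow m f) (sumBelow m g) (f m) (g m)
    where lemma : ∀ a b c d → a + b + (c + d) ≡ a + c + (b + d)
          lemma = solve-∀

  *-distribˡ-∑ : ∀ m c (f : ℕ → ℕ) → ∑[ i < m ] (c * f i) ≡ c * ∑[ i < m ] f i
  *-distribˡ-∑ zero c f = sym (*-zeroʳ c)
  *-distribˡ-∑ (suc m) c f rewrite *-distribˡ-∑ m c f = sym (*-distribˡ-+ c (sumBelow m f) (f m))

  ∑-mono-≤ : ∀ m (f g : ℕ → ℕ) → (∀ i → i < m → f i ≤ g i) → ∑[ i < m ] f i ≤ ∑[ i < m ] g i
  ∑-mono-≤ zero f g h = z≤n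
  ∑-mono-≤ (suc m) f g h = +-mono-≤ (∑-mono-≤ m f g (λ i i<m → h i (m<n⇒m<1+n i<m))) (h m ≤-refl)

  ∑-zero : ∀ m → ∑[ i < m ] 0 ≡ 0
  ∑-zero zero = refl
  ∑-zero (suc m) = trans (+-identityʳ _) (∑-zero m)

  indicator : Bool → ℕ
  indicator true = 1
  indicator false = 0

  count : (ℕ → Bool) → ℕ → ℕ
  count f zero = 0
  count f (suc m) = count f m + indicator (f m)

  ∑-indicator : ∀ m (f : ℕ → Bool) → ∑[ c < m ] indicator (f c) ≡ count f m
  ∑-indicator zero f = refl
  ∑-indicator (suc m) f = cong (_+ indicator (f m)) (∑-indicator m f)

  count-cong : ∀ {f g} m → (∀ x → x < m → f x ≡ g x) → count f m ≡ count g m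
  count-cong zero h = refl
  count-cong (suc m) h = cong₂ _+_ (count-cong m (λ x x<m → h x (m<n⇒m<1+n x<m))) (cong indicator (h m ≤-refl))

  ∑-indicator-≟ : ∀ y P → ∑[ c < P ] indicator (does (y ≟ c)) ≡ indicator (does (y <? P))
  ∑-indicator-≟ y zero = refl
  ∑-indicator-≟ y (suc P) rewrite ∑-indicator-≟ y P with <-cmp y P
  ... | tri< y<P _ _
    rewrite dec-true (y <? P) y<P | dec-false (y ≟ P) (<⇒≢ y<P) | dec-true (y <? suc P) (m<n⇒m<1+n y<P) = refl
  ... | tri≈ _ refl _
    rewrite dec-false (y <? y) (<-irrefl refl) | dec-true (y ≟ y) refl | dec-true (y <? suc y) (n<1+n y) = refl
  ... | tri> _ _ P<y
    rewrite dec-false (y <? P) (<⇒≯ P<y) | dec-false (y ≟ P) (>⇒≢ P<y) | dec-false (y <? suc P) (<⇒≱ P<y ∘ ≤-pred) = refl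

  fibre-sum : ∀ (A : ℕ → Bool) (g : ℕ → ℕ) P M →
    ∑[ c < P ] count (λ w → A w ∧ does (g w ≟ c)) M ≡ count (λ w → A w ∧ does (g w <? P)) M
  fibre-sum A g P zero = ∑-zero P
  fibre-sum A g P (suc M) = begin
    ∑[ c < P ] (count (λ w → A w ∧ does (g w ≟ c)) M + indicator (A M ∧ does (g M ≟ c)))
      ≡⟨ ∑-distrib-+ P (λ c → count (λ w → A w ∧ does (g w ≟ c)) M) (λ c → indicator (A M ∧ does (g M ≟ c))) ⟩
    ∑[ c < P ] count (λ w → A w ∧ does (g w ≟ c)) M + ∑[ c < P ] indicator (A M ∧ does (g M ≟ c))
      ≡⟨ cong₂ _+_ (fibre-sum A g P M) (last-term (A M)) ⟩
    count (λ w → A w ∧ does (g w <? P)) M + indicator (A M ∧ does (g M <? P)) ∎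
    where
    open ≡-Reasoning
    last-term : ∀ b → ∑[ c < P ] indicator (b ∧ does (g M ≟ c)) ≡ indicator (b ∧ does (g M <? P))
    last-term true = ∑-indicator-≟ (g M) P
    last-term false = ∑-zero P

  count-split : ∀ (g f : ℕ → Bool) m → count g m ≡ count (λ x → g x ∧ f x) m + count (λ x → g x ∧ not (f x)) m
  count-split g f zero = refl
  count-split g f (suc m) = begin
    count g m + indicator (g m)       ≡⟨ cong₂ _+_ (count-split g f m) (indicator-split (g m) (f m)) ⟩
    (a + b) + (c + d)                 ≡⟨ lemma a b c d ⟩
    (a + c) + (b + d)                 ∎
    where
    open ≡-Reasoning
    a = count (λ x → g x ∧ f x) m
    b = count (λ x → g x ∧ not (f x)) m
    c = indicator (g m ∧ f m)
    d = indicator (g m ∧ not (f m))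
    indicator-split : ∀ a b → indicator a ≡ indicator (a ∧ b) + indicator (a ∧ not b)
    indicator-split true true = refl
    indicator-split true false = refl
    indicator-split false b = refl
    lemma : ∀ a b c d → a + b + (c + d) ≡ (a + c) + (b + d)
    lemma = solve-∀

  count-all : ∀ m → count (λ _ → true) m ≡ m
  count-all zero = refl
  count-all (suc m) = trans (cong (_+ 1) (count-all m)) (+-comm m 1)

  count-complement : ∀ f m → count f m + count (λ x → not (f x)) m ≡ m
  count-complement f m = trans (sym (count-split (λ _ → true) f m)) (count-all m)

  count-none : ∀ f m → (∀ x → x < m → f x ≡ false) → count f m ≡ 0
  count-none f zero none = refl
  count-none f (suc m) none rewrite none m ≤-refl = trans (+-identityʳ _) (count-none f m λ x x<m → none x (m<n⇒m<1+n x<m))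

  count-nonzero : ∀ m → count (λ w → not (does (w ≟ 0))) m ≡ m ∸ 1
  count-nonzero zero = refl
  count-nonzero (suc m) = begin
    count nonzero (suc m)                             ≡⟨ m+n∸m≡n (count zero? (suc m)) (count nonzero (suc m)) ⟨
    count zero? (suc m) + count nonzero (suc m) ∸ count zero? (suc m)
      ≡⟨ cong₂ _∸_ (count-complement zero? (suc m)) (count-zero m) ⟩
    suc m ∸ 1                                         ∎
    where
    open ≡-Reasoning
    zero? = λ w → does (w ≟ 0)
    nonzero = λ w → not (does (w ≟ 0))
    count-zero : ∀ m → count zero? (suc m) ≡ 1
    count-zero zero = refl
    count-zero (suc m) = cong (_+ 0) (count-zero m)

  count>0⇒∃ : ∀ f m → 0 < count f m → Σ ℕ λ x → x < m × f x ≡ true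
  count>0⇒∃ f (suc m) pos with f m in fm
  ... | true = m , ≤-refl , fm
  ... | false with count>0⇒∃ f m (subst (0 <_) (+-identityʳ (count f m)) pos)
  ... | x , x<m , fx = x , m<n⇒m<1+n x<m , fx

  count-remove : ∀ {B} M y → y < M → B y ≡ true → count B M ≡ suc (count (λ x → B x ∧ not (does (x ≟ y))) M)
  count-remove {B} (suc M) y y<M By with y ≟ M
  ... | yes refl = begin
    count B y + indicator (B y)          ≡⟨ cong (λ b → count B y + indicator b) By ⟩
    count B y + 1                        ≡⟨ +-comm (count B y) 1 ⟩
    suc (count B y)                      ≡⟨ cong suc (count-cong y λ x x<y → sym (without-y x (<⇒≢ x<y))) ⟩
    suc (count B′ y)                     ≡⟨ cong suc (+-identityʳ (count B′ y)) ⟨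
    suc (count B′ y + 0)                 ≡⟨ cong (λ b → suc (count B′ y + indicator b)) B′y≡false ⟨
    suc (count B′ y + indicator (B′ y))  ∎
    where
    open ≡-Reasoning
    B′ = λ x → B x ∧ not (does (x ≟ y))
    B′y≡false : B′ y ≡ false
    B′y≡false = trans (cong (λ b → B y ∧ not b) (dec-true (y ≟ y) refl)) (∧-zeroʳ (B y))
    without-y : ∀ x → x ≢ y → B′ x ≡ B x
    without-y x x≢y = trans (cong (λ b → B x ∧ not b) (dec-false (x ≟ y) x≢y)) (∧-identityʳ (B x))
  ... | no y≢M = begin
    count B M + indicator (B M)          ≡⟨ cong (_+ indicator (B M)) (count-remove M y (≤∧≢⇒< (≤-pred y<M) y≢M) By) ⟩
    suc (count B′ M + indicator (B M))   ≡⟨ cong (λ b → suc (count B′ M + indicator b)) without-y ⟨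
    suc (count B′ M + indicator (B′ M))  ∎
    where
    open ≡-Reasoning
    B′ = λ x → B x ∧ not (does (x ≟ y))
    without-y : B′ M ≡ B M
    without-y = trans (cong (λ b → B M ∧ not b) (dec-false (M ≟ y) (y≢M ∘ sym))) (∧-identityʳ (B M))

  count-injection : ∀ {A B : ℕ → Bool} (φ : ℕ → ℕ) M P →
    (∀ c → c < P → A c ≡ true → φ c < M × B (φ c) ≡ true) →
    (∀ c c′ → c < P → c′ < P → A c ≡ true → A c′ ≡ true → φ c ≡ φ c′ → c ≡ c′) →
    count A P ≤ count B M
  count-injection φ M zero maps inj = z≤n
  count-injection {A} {B} φ M (suc P) maps inj with A P in AP
  ... | false = subst (_≤ count B M) (sym (+-identityʳ (count A P)))
                  (count-injection φ M P (λ c c<P → maps c (m<n⇒m<1+n c<P)) inj′)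
    where inj′ = λ c c′ c<P c′<P → inj c c′ (m<n⇒m<1+n c<P) (m<n⇒m<1+n c′<P)
  ... | true = begin
    count A P + 1     ≡⟨ +-comm (count A P) 1 ⟩
    suc (count A P)   ≤⟨ s≤s (count-injection {A} {B′} φ M P maps′ inj′) ⟩
    suc (count B′ M)  ≡⟨ count-remove {B} M (φ P) φP<M BφP ⟨
    count B M         ∎
    where
    open ≤-Reasoning
    φP<M = proj₁ (maps P ≤-refl AP)
    BφP = proj₂ (maps P ≤-refl AP)
    B′ = λ x → B x ∧ not (does (x ≟ φ P))
    inj′ : ∀ c c′ → c < P → c′ < P → A c ≡ true → A c′ ≡ true → φ c ≡ φ c′ → c ≡ c′
    inj′ c c′ c<P c′<P = inj c c′ (m<n⇒m<1+n c<P) (m<n⇒m<1+n c′<P)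
    maps′ : ∀ c → c < P → A c ≡ true → φ c < M × B′ (φ c) ≡ true
    maps′ c c<P Ac = proj₁ (maps c (m<n⇒m<1+n c<P) Ac) ,
      trans (cong (λ b → B (φ c) ∧ not b) (dec-false (φ c ≟ φ P) φc≢φP))
            (trans (∧-identityʳ (B (φ c))) (proj₂ (maps c (m<n⇒m<1+n c<P) Ac)))
      where φc≢φP = λ φc≡φP → <⇒≢ c<P (inj c P (m<n⇒m<1+n c<P) ≤-refl Ac AP φc≡φP)

  count-mono : ∀ {A B : ℕ → Bool} M → (∀ c → c < M → A c ≡ true → B c ≡ true) → count A M ≤ count B M
  count-mono M A⇒B = count-injection (λ x → x) M M (λ c c<M Ac → c<M , A⇒B c c<M Ac) (λ _ _ _ _ _ _ e → e)

  ∃⇒count≥1 : ∀ f m x → x < m → f x ≡ true → 1 ≤ count f m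
  ∃⇒count≥1 f m x x<m fx = count-injection {λ _ → true} {f} (λ _ → x) m 1 (λ _ _ _ → x<m , fx) single
    where single : ∀ c c′ → c < 1 → c′ < 1 → _ → _ → _ → c ≡ c′
          single zero zero _ _ _ _ _ = refl
          single (suc _) _ (s≤s ()) _ _ _ _
          single _ (suc _) _ (s≤s ()) _ _ _

  anyBelow : ℕ → (ℕ → Bool) → Bool
  anyBelow zero f = false
  anyBelow (suc M) f = anyBelow M f ∨ f M

  witnessBelow : ℕ → (ℕ → Bool) → ℕ
  witnessBelow zero f = 0
  witnessBelow (suc M) f = if anyBelow M f then witnessBelow M f else M

  anyBelow-intro : ∀ M f x → x < M → f x ≡ true → anyBelow M f ≡ true
  anyBelow-intro (suc M) f x x<M fx with x ≟ M
  ... | yes refl rewrite fx = ∨-zeroʳ (anyBelow x f)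
  ... | no x≢M rewrite anyBelow-intro M f x (≤∧≢⇒< (≤-pred x<M) x≢M) fx = refl

  witnessBelow-spec : ∀ M f → anyBelow M f ≡ true → witnessBelow M f < M × f (witnessBelow M f) ≡ true
  witnessBelow-spec (suc M) f any with anyBelow M f in anyM
  ... | true = let w<M , fw = witnessBelow-spec M f anyM in m<n⇒m<1+n w<M , fw
  ... | false = ≤-refl , any

  anyBelow-false : ∀ M f → anyBelow M f ≡ false → ∀ x → x < M → f x ≡ false
  anyBelow-false M f none x x<M with f x in fx
  ... | false = refl
  ... | true = trans (sym (anyBelow-intro M f x x<M fx)) none

module Lagrange where

  open import Data.Nat as ℕ using (ℕ; zero; suc; _≤_; _<_; z≤n; s≤s)
  import Data.Nat.Properties as ℕP
  open import Data.Nat.Primality using (Prime)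
  open import Data.Integer using (ℤ; +_; -_; _+_; _*_; _-_; 0ℤ; 1ℤ; _^_)
  import Data.Integer.Properties as ℤP
  open import Data.Integer.Tactic.RingSolver using (solve-∀)
  open import Data.List using (List; []; _∷_; length; zipWith; replicate; _++_; [_])
  import Data.List.Properties as ListP
  open import Data.Bool using (Bool; true; _∧_; not)
  open import Data.Product using (_,_)
  open import Data.Sum using (inj₁; inj₂)
  open import Data.Empty using (⊥-elim)
  open import Relation.Nullary using (yes; no; does)
  open import Relation.Binary.PropositionalEquality hiding ([_])
  open Congruence
  open Counting

  -- Polynomials are coefficient lists, leading coefficient first.
  eval : List ℤ → ℤ → ℤ
  eval [] x = 0ℤ
  eval (c ∷ cs) x = c * x ^ length cs + eval cs x

  leading : List ℤ → ℤ
  leading [] = 0ℤ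
  leading (c ∷ _) = c

  geometric : ℤ → ℤ → ℕ → List ℤ
  geometric c a zero = []
  geometric c a (suc d) = c ∷ geometric (c * a) a d

  length-geometric : ∀ c a d → length (geometric c a d) ≡ d
  length-geometric c a zero = refl
  length-geometric c a (suc d) = cong suc (length-geometric (c * a) a d)

  eval-geometric : ∀ c a d x → (x - a) * eval (geometric c a d) x ≡ c * (x ^ d - a ^ d)
  eval-geometric c a zero x = lemma x a c
    where lemma : ∀ x a c → (x - a) * 0ℤ ≡ c * (1ℤ - 1ℤ)
          lemma = solve-∀
  eval-geometric c a (suc d) x rewrite length-geometric (c * a) a d = begin
    (x - a) * (c * x ^ d + eval (geometric (c * a) a d) x)              ≡⟨ ℤP.*-distribˡ-+ (x - a) _ _ ⟩
    (x - a) * (c * x ^ d) + (x - a) * eval (geometric (c * a) a d) x    ≡⟨ cong (λ z → (x - a) * (c * x ^ d) + z) (eval-geometric (c * a) a d x) ⟩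
    (x - a) * (c * x ^ d) + c * a * (x ^ d - a ^ d)                     ≡⟨ lemma x a c (x ^ d) (a ^ d) ⟩
    c * (x * x ^ d - a * a ^ d)                                         ∎
    where
    open ≡-Reasoning
    lemma : ∀ x a c X A → (x - a) * (c * X) + c * a * (X - A) ≡ c * (x * X - a * A)
    lemma = solve-∀

  eval-zipWith-+ : ∀ u v x → length u ≡ length v → eval (zipWith _+_ u v) x ≡ eval u x + eval v x
  eval-zipWith-+ [] [] x _ = refl
  eval-zipWith-+ (a ∷ u) (b ∷ v) x e with ℕP.suc-injective e
  ... | e′ rewrite eval-zipWith-+ u v x e′ | ListP.length-zipWith _+_ u v | e′ | ℕP.⊓-idem (length v) =
    lemma a b (x ^ length v) (eval u x) (eval v x)
    where lemma : ∀ a b X U V → (a + b) * X + (U + V) ≡ a * X + U + (b * X + V)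
          lemma = solve-∀

  quotient-by : ℤ → List ℤ → List ℤ
  quotient-by a [] = []
  quotient-by a (c ∷ cs) = zipWith _+_ (geometric c a (length cs)) (0ℤ ∷ quotient-by a cs)

  length-quotient-by : ∀ a cs → length (quotient-by a cs) ≡ ℕ.pred (length cs)
  length-quotient-by a [] = refl
  length-quotient-by a (c ∷ []) = refl
  length-quotient-by a (c ∷ c′ ∷ cs) = begin
    length (zipWith _+_ (geometric c a (suc (length cs))) (0ℤ ∷ quotient-by a (c′ ∷ cs)))
      ≡⟨ ListP.length-zipWith _+_ (geometric c a (suc (length cs))) (0ℤ ∷ quotient-by a (c′ ∷ cs)) ⟩
    length (geometric c a (suc (length cs))) ℕ.⊓ suc (length (quotient-by a (c′ ∷ cs)))
      ≡⟨ cong₂ ℕ._⊓_ (length-geometric c a (suc (length cs))) (cong suc (length-quotient-by a (c′ ∷ cs))) ⟩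
    suc (length cs) ℕ.⊓ suc (length cs)   ≡⟨ ℕP.⊓-idem _ ⟩
    suc (length cs)                       ∎
    where open ≡-Reasoning

  eval-quotient-by : ∀ a f x → eval f x - eval f a ≡ (x - a) * eval (quotient-by a f) x
  eval-quotient-by a [] x = lemma x a
    where lemma : ∀ x a → 0ℤ - 0ℤ ≡ (x - a) * 0ℤ
          lemma = solve-∀
  eval-quotient-by a (c ∷ []) x = lemma c x a
    where lemma : ∀ c x a → c * 1ℤ + 0ℤ - (c * 1ℤ + 0ℤ) ≡ (x - a) * 0ℤ
          lemma = solve-∀
  eval-quotient-by a (c ∷ cs@(_ ∷ _)) x = begin
    c * x ^ d + eval cs x - (c * a ^ d + eval cs a)                       ≡⟨ lemma c (x ^ d) (a ^ d) (eval cs x) (eval cs a) ⟩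
    c * (x ^ d - a ^ d) + (eval cs x - eval cs a)                         ≡⟨ cong₂ _+_ (sym (eval-geometric c a d x)) (eval-quotient-by a cs x) ⟩
    (x - a) * eval (geometric c a d) x + (x - a) * eval (quotient-by a cs) x ≡⟨ ℤP.*-distribˡ-+ (x - a) _ _ ⟨
    (x - a) * (eval (geometric c a d) x + eval (quotient-by a cs) x)
      ≡⟨ cong (λ z → (x - a) * (eval (geometric c a d) x + z)) (ℤP.+-identityˡ _) ⟨
    (x - a) * (eval (geometric c a d) x + eval (0ℤ ∷ quotient-by a cs) x)
      ≡⟨ cong ((x - a) *_) (eval-zipWith-+ (geometric c a d) (0ℤ ∷ quotient-by a cs) x lengths) ⟨
    (x - a) * eval (quotient-by a (c ∷ cs)) x                             ∎
    where
    open ≡-Reasoning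
    d = length cs
    lemma : ∀ c X A E F → c * X + E - (c * A + F) ≡ c * (X - A) + (E - F)
    lemma = solve-∀
    lengths : length (geometric c a d) ≡ suc (length (quotient-by a cs))
    lengths = trans (length-geometric c a d) (cong suc (sym (length-quotient-by a cs)))

  module _ {p : ℕ} (pr : Prime p) where

    root-of-quotient : ∀ f a x → a < p → x < p → x ≢ a →
      eval f (+ a) ≡ 0ℤ [mod + p ] → eval f (+ x) ≡ 0ℤ [mod + p ] → eval (quotient-by (+ a) f) (+ x) ≡ 0ℤ [mod + p ]
    root-of-quotient f a x a<p x<p x≢a fa≡0 fx≡0
      with euclidsLemma-mod pr (+ x - + a) (eval (quotient-by (+ a) f) (+ x))
             (subst (_≡ 0ℤ [mod + p ]) (eval-quotient-by (+ a) f (+ x)) (mod⇒-≡0-mod (mod-trans fx≡0 (mod-sym fa≡0))))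
    ... | inj₁ x-a≡0 = ⊥-elim (x≢a (mod-<-injective x<p a<p (-≡0-mod⇒mod x-a≡0)))
    ... | inj₂ q≡0 = q≡0

    lagrange : ∀ d (f : List ℤ) → length f ≡ suc d → Unit p (leading f) →
      (B : ℕ → Bool) → (∀ x → x < p → B x ≡ true → eval f (+ x) ≡ 0ℤ [mod + p ]) → count B p ≤ d
    lagrange zero (c ∷ []) _ uc B roots with 0 ℕ.<? count B p
    ... | no none = ℕP.≮⇒≥ none
    ... | yes some with count>0⇒∃ B p some
    ...   | x , x<p , Bx = ⊥-elim (uc (subst (_≡ 0ℤ [mod + p ]) (lemma c) (roots x x<p Bx)))
      where lemma : ∀ c → c * 1ℤ + 0ℤ ≡ c
            lemma = solve-∀
    lagrange (suc d) f@(c ∷ _ ∷ _) len uc B roots with 0 ℕ.<? count B p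
    ... | no none = ℕP.≤-trans (ℕP.≮⇒≥ none) z≤n
    ... | yes some with count>0⇒∃ B p some
    ...   | a , a<p , Ba = begin
      count B p          ≡⟨ count-remove p a a<p Ba ⟩
      suc (count B′ p)   ≤⟨ s≤s (lagrange d q length-q unit-q B′ roots′) ⟩
      suc d              ∎
      where
      open ℕP.≤-Reasoning
      q = quotient-by (+ a) f
      B′ = λ x → B x ∧ not (does (x ℕ.≟ a))
      length-q : length q ≡ suc d
      length-q = trans (length-quotient-by (+ a) f) (ℕP.suc-injective len)
      unit-q : Unit p (leading q)
      unit-q = subst (Unit p) (sym (ℤP.+-identityʳ c)) uc
      roots′ : ∀ x → x < p → B′ x ≡ true → eval q (+ x) ≡ 0ℤ [mod + p ]
      roots′ x x<p B′x = let Bx , x≢a = ∧≡true B′x in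
        root-of-quotient f a x a<p x<p (not-does⇒¬ (x ℕ.≟ a) x≢a) (roots a a<p Ba) (roots x x<p Bx)

    power-root-count : ∀ d C (B : ℕ → Bool) → (∀ x → x < p → B x ≡ true → (+ x) ^ suc d ≡ C [mod + p ]) →
      count B p ≤ suc d
    power-root-count d C B roots = lagrange (suc d) X^[1+d]-C length-X^[1+d]-C (unit-1 pr) B
      (λ x x<p Bx → subst (_≡ 0ℤ [mod + p ]) (sym (eval-X^[1+d]-C (+ x))) (mod⇒-≡0-mod (roots x x<p Bx)))
      where
      zeros++[-C] : ℕ → List ℤ
      zeros++[-C] n = replicate n 0ℤ ++ [ - C ]
      length-zeros++[-C] : ∀ n → length (zeros++[-C] n) ≡ suc n
      length-zeros++[-C] zero = refl
      length-zeros++[-C] (suc n) = cong suc (length-zeros++[-C] n)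
      eval-zeros++[-C] : ∀ n x → eval (zeros++[-C] n) x ≡ - C
      eval-zeros++[-C] zero x = trans (ℤP.+-identityʳ (- C * 1ℤ)) (ℤP.*-identityʳ (- C))
      eval-zeros++[-C] (suc n) x = trans (cong (_+ eval (zeros++[-C] n) x) (ℤP.*-zeroˡ (x ^ length (zeros++[-C] n))))
                                      (trans (ℤP.+-identityˡ _) (eval-zeros++[-C] n x))
      X^[1+d]-C : List ℤ
      X^[1+d]-C = 1ℤ ∷ zeros++[-C] d
      length-X^[1+d]-C : length X^[1+d]-C ≡ suc (suc d)
      length-X^[1+d]-C = cong suc (length-zeros++[-C] d)
      eval-X^[1+d]-C : ∀ x → eval X^[1+d]-C x ≡ x ^ suc d - C
      eval-X^[1+d]-C x rewrite length-zeros++[-C] d | eval-zeros++[-C] d x = cong (_- C) (ℤP.*-identityˡ (x ^ suc d))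

module PowerResidues where

  open import Data.Nat as ℕ using (ℕ; suc; _≤_; _<_; _≟_; _<?_)
  import Data.Nat.Properties as ℕP
  open import Data.Nat.DivMod using (_%_; m%n<n)
  open import Data.Nat.Divisibility as ℕD using ()
  open import Data.Nat.GCD using (gcd; gcd-GCD; module Bézout; gcd[m,n]≢0)
  open import Data.Nat.Primality using (Prime; prime⇒nonZero)
  open import Data.Integer using (+_; _*_; 1ℤ; _^_)
  import Data.Integer.Properties as ℤP
  open import Data.Bool using (Bool; true; false; _∧_; not)
  open import Data.Bool.Properties using (∧-identityʳ)
  open import Data.Product using (_,_; proj₁; proj₂; _×_)
  open import Data.Sum using (inj₂)
  open import Relation.Nullary using (does)
  open import Relation.Nullary.Decidable using (dec-true)
  open import Relation.Binary.PropositionalEquality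
  import Relation.Binary.Reasoning.Setoid as SetoidReasoning
  open Congruence
  open Fermat using (fermat-little)
  open Counting
  open Lagrange using (power-root-count)

  module _ {p : ℕ} (pr : Prime p) where

    private
      ^-split : ∀ a e y n → a ^ (e ℕ.+ y ℕ.* n) ≡ a ^ e * (a ^ n) ^ y
      ^-split a e y n = trans (ℤP.^-distribˡ-+-* a e (y ℕ.* n))
                              (cong (a ^ e *_) (trans (cong (a ^_) (ℕP.*-comm y n)) (sym (ℤP.^-*-assoc a n y))))

      ^[p-1]^y≡1 : ∀ {a} → Unit p a → ∀ y → (a ^ (p ℕ.∸ 1)) ^ y ≡ 1ℤ [mod + p ]
      ^[p-1]^y≡1 ua y = mod-trans (^-cong-mod (fermat-little pr ua) y) (subst (_≡ 1ℤ [mod + p ]) (sym (ℤP.^-zeroˡ y)) mod-refl)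

    -- Writing gcd(k, p−1) = x k − y (p−1) or y (p−1) − x k and using Fermat's little theorem.
    powers-gcd : ∀ k {a b} → Unit p a → Unit p b → a ^ k ≡ b ^ k [mod + p ] →
      a ^ gcd k (p ℕ.∸ 1) ≡ b ^ gcd k (p ℕ.∸ 1) [mod + p ]
    powers-gcd k {a} {b} ua ub a^k≡b^k with Bézout.identity (gcd-GCD k (p ℕ.∸ 1))
    ... | Bézout.+- x y e+y[p-1]≡xk = begin
      a ^ e                          ≡⟨ ℤP.*-identityʳ (a ^ e) ⟨
      a ^ e * 1ℤ                     ≈⟨ *-cong-mod (mod-refl {a = a ^ e}) (mod-sym (^[p-1]^y≡1 ua y)) ⟩
      a ^ e * (a ^ (p ℕ.∸ 1)) ^ y    ≡⟨ ^-split a e y (p ℕ.∸ 1) ⟨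
      a ^ (e ℕ.+ y ℕ.* (p ℕ.∸ 1))    ≡⟨ cong (a ^_) e+y[p-1]≡xk ⟩
      a ^ (x ℕ.* k)                  ≡⟨ cong (a ^_) (ℕP.*-comm x k) ⟩
      a ^ (k ℕ.* x)                  ≡⟨ ℤP.^-*-assoc a k x ⟨
      (a ^ k) ^ x                    ≈⟨ ^-cong-mod a^k≡b^k x ⟩
      (b ^ k) ^ x                    ≡⟨ ℤP.^-*-assoc b k x ⟩
      b ^ (k ℕ.* x)                  ≡⟨ cong (b ^_) (ℕP.*-comm k x) ⟩
      b ^ (x ℕ.* k)                  ≡⟨ cong (b ^_) e+y[p-1]≡xk ⟨
      b ^ (e ℕ.+ y ℕ.* (p ℕ.∸ 1))    ≡⟨ ^-split b e y (p ℕ.∸ 1) ⟩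
      b ^ e * (b ^ (p ℕ.∸ 1)) ^ y    ≈⟨ *-cong-mod (mod-refl {a = b ^ e}) (^[p-1]^y≡1 ub y) ⟩
      b ^ e * 1ℤ                     ≡⟨ ℤP.*-identityʳ (b ^ e) ⟩
      b ^ e                          ∎
      where
      open SetoidReasoning (mod-setoid (+ p))
      e = gcd k (p ℕ.∸ 1)
    ... | Bézout.-+ x y e+xk≡y[p-1] = *-cancelʳ-unit-mod pr (unit-^ pr (unit-^ pr ua k) x) (begin
      a ^ e * (a ^ k) ^ x            ≈⟨ ≡1 ua ⟩
      1ℤ                             ≈⟨ mod-sym (≡1 ub) ⟩
      b ^ e * (b ^ k) ^ x            ≈⟨ *-cong-mod (mod-refl {a = b ^ e}) (^-cong-mod (mod-sym a^k≡b^k) x) ⟩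
      b ^ e * (a ^ k) ^ x            ∎)
      where
      open SetoidReasoning (mod-setoid (+ p))
      e = gcd k (p ℕ.∸ 1)
      ≡1 : ∀ {c} → Unit p c → c ^ e * (c ^ k) ^ x ≡ 1ℤ [mod + p ]
      ≡1 {c} uc = begin
        c ^ e * (c ^ k) ^ x          ≡⟨ ^-split c e x k ⟨
        c ^ (e ℕ.+ x ℕ.* k)          ≡⟨ cong (c ^_) e+xk≡y[p-1] ⟩
        c ^ (y ℕ.* (p ℕ.∸ 1))        ≡⟨ cong (c ^_) (ℕP.*-comm y (p ℕ.∸ 1)) ⟩
        c ^ ((p ℕ.∸ 1) ℕ.* y)        ≡⟨ ℤP.^-*-assoc c (p ℕ.∸ 1) y ⟨
        (c ^ (p ℕ.∸ 1)) ^ y          ≈⟨ ^[p-1]^y≡1 uc y ⟩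
        1ℤ                           ∎

  module Residues {p : ℕ} (pr : Prime p) (k : ℕ) where

    private instance
      p≢0 : ℕ.NonZero p
      p≢0 = prime⇒nonZero pr

    e : ℕ
    e = gcd k (p ℕ.∸ 1)

    unitRoot : ℕ → ℕ → Bool
    unitRoot c w = not (does (w ≟ 0)) ∧ does ((w ℕ.^ k) % p ≟ c)

    isPower : ℕ → Bool
    isPower c = anyBelow p (unitRoot c)

    root : ℕ → ℕ
    root c = witnessBelow p (unitRoot c)

    nonzero-unit : ∀ w → w < p → not (does (w ≟ 0)) ≡ true → Unit p (+ w)
    nonzero-unit w w<p w≢0 w≡0 with ℕD.∣⇒≤ {{ℕ.≢-nonZero (not-does⇒¬ (w ≟ 0) w≢0)}} (≡0-mod⇒∣ w≡0)
    ... | p≤w = ℕP.<⇒≱ w<p p≤w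

    unitRoot-power : ∀ c w → unitRoot c w ≡ true → + (w ℕ.^ k) ≡ + c [mod + p ]
    unitRoot-power c w isRoot =
      subst (λ z → + (w ℕ.^ k) ≡ + z [mod + p ]) (does≡true⇒ ((w ℕ.^ k) % p ≟ c) (proj₂ (∧≡true isRoot))) (≡-mod-% (+ (w ℕ.^ k)))

    root-spec : ∀ c → isPower c ≡ true → root c < p × unitRoot c (root c) ≡ true
    root-spec c = witnessBelow-spec p (unitRoot c)

    root-unit : ∀ c → isPower c ≡ true → Unit p (+ root c)
    root-unit c power = let root<p , isRoot = root-spec c power in
      nonzero-unit (root c) root<p (proj₁ (∧≡true isRoot))

    root-power : ∀ c → isPower c ≡ true → + (root c ℕ.^ k) ≡ + c [mod + p ]
    root-power c power = unitRoot-power c (root c) (proj₂ (root-spec c power))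

    e≢0 : e ≢ 0
    e≢0 = gcd[m,n]≢0 k (p ℕ.∸ 1) (inj₂ (λ p∸1≡0 → ℕP.<⇒≱ (2≤p pr) (ℕP.m∸n≡0⇒m≤n p∸1≡0)))

    -- All unit roots of c are roots of X^e − root(c)^e, so Lagrange bounds them by e.
    roots≤e : ∀ c → isPower c ≡ true → count (unitRoot c) p ≤ e
    roots≤e c power = subst (count (unitRoot c) p ≤_) 1+[e-1]≡e
      (power-root-count pr (ℕ.pred e) ((+ root c) ^ suc (ℕ.pred e)) (unitRoot c) roots)
      where
      1+[e-1]≡e : suc (ℕ.pred e) ≡ e
      1+[e-1]≡e = ℕP.suc-pred e {{ℕ.≢-nonZero e≢0}}
      roots : ∀ x → x < p → unitRoot c x ≡ true → (+ x) ^ suc (ℕ.pred e) ≡ (+ root c) ^ suc (ℕ.pred e) [mod + p ]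
      roots x x<p isRoot = subst (λ n → (+ x) ^ n ≡ (+ root c) ^ n [mod + p ]) (sym 1+[e-1]≡e)
        (powers-gcd pr k (nonzero-unit x x<p (proj₁ (∧≡true isRoot))) (root-unit c power) (begin
          (+ x) ^ k            ≡⟨ pos-^ x k ⟨
          + (x ℕ.^ k)          ≈⟨ unitRoot-power c x isRoot ⟩
          + c                  ≈⟨ mod-sym (root-power c power) ⟩
          + (root c ℕ.^ k)     ≡⟨ pos-^ (root c) k ⟩
          (+ root c) ^ k       ∎))
        where open SetoidReasoning (mod-setoid (+ p))

    roots≤e*indicator : ∀ c → c < p → count (unitRoot c) p ≤ e ℕ.* indicator (isPower c)
    roots≤e*indicator c c<p with isPower c in power
    ... | true = subst (count (unitRoot c) p ≤_) (sym (ℕP.*-identityʳ e)) (roots≤e c power)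
    ... | false = ℕP.≤-reflexive (trans (count-none (unitRoot c) p (anyBelow-false p (unitRoot c) power)) (sym (ℕP.*-zeroʳ e)))

    -- Every unit is a root of exactly one residue, so the p − 1 units are spread over the fibres.
    power-residue-count : p ℕ.∸ 1 ≤ e ℕ.* count isPower p
    power-residue-count = begin
      p ℕ.∸ 1                                                ≡⟨ count-nonzero p ⟨
      count nonzero p                                        ≡⟨ count-cong p (λ w w<p → sym (residue<p w)) ⟩
      count (λ w → nonzero w ∧ does ((w ℕ.^ k) % p <? p)) p  ≡⟨ fibre-sum nonzero (λ w → (w ℕ.^ k) % p) p p ⟨
      ∑[ c < p ] count (unitRoot c) p                        ≤⟨ ∑-mono-≤ p _ _ roots≤e*indicator ⟩
      ∑[ c < p ] (e ℕ.* indicator (isPower c))               ≡⟨ *-distribˡ-∑ p e (λ c → indicator (isPower c)) ⟩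
      e ℕ.* ∑[ c < p ] indicator (isPower c)                 ≡⟨ cong (e ℕ.*_) (∑-indicator p isPower) ⟩
      e ℕ.* count isPower p                                  ∎
      where
      open ℕP.≤-Reasoning
      nonzero = λ w → not (does (w ≟ 0))
      residue<p : ∀ w → nonzero w ∧ does ((w ℕ.^ k) % p <? p) ≡ nonzero w
      residue<p w = trans (cong (nonzero w ∧_) (dec-true ((w ℕ.^ k) % p <? p) (m%n<n (w ℕ.^ k) p))) (∧-identityʳ _)

module SumsOfPowers where

  open import Data.Nat as ℕ using (ℕ; zero; suc; _≤_; _<_; _≟_)
  import Data.Nat.Properties as ℕP
  open import Data.Nat.DivMod using (_%_; m%n<n; m<n⇒m%n≡m)
  open import Data.Nat.Primality using (Prime; prime⇒nonZero)
  open import Data.Nat.Tactic.RingSolver as ℕSolver using ()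
  open import Data.Integer as ℤ using (ℤ; +_; -_; _+_; _*_; _-_; 0ℤ; 1ℤ; _^_)
  import Data.Integer.Properties as ℤP
  import Data.Integer.DivMod as ℤDM
  open import Data.Integer.Tactic.RingSolver using (solve-∀)
  open import Data.Vec using (Vec; []; _∷_)
  open import Data.Bool using (Bool; true; false; _∧_; not)
  open import Data.Bool.Properties using (not-involutive)
  open import Data.Product using (Σ; _,_; proj₁; proj₂; _×_)
  open import Data.Sum using (_⊎_; inj₁; inj₂)
  open import Data.Empty using (⊥-elim)
  open import Relation.Nullary using (yes; no; does)
  open import Relation.Nullary.Decidable using (dec-true)
  open import Relation.Binary.PropositionalEquality
  import Relation.Binary.Reasoning.Setoid as SetoidReasoning
  open Congruence
  open Fermat using (0^n≡0; inverse-mod; unit-cancel-mod)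
  open Counting
  open PowerResidues using (module Residues)

  powerSum : ∀ {n} → ℕ → Vec ℤ n → ℤ
  powerSum k [] = 0ℤ
  powerSum k (y ∷ ys) = y ^ k + powerSum k ys

  Representable : ℕ → ℕ → ℕ → ℕ → ℤ → Set
  Representable p k s h n = Σ ℤ λ w → Unit p w × Σ (Vec ℤ s) λ ys → n ≡ w ^ k + powerSum k ys [mod p ^ᶻ h ]

  module ModPrimePower {p : ℕ} (pr : Prime p) (k : ℕ) (k≥1 : 1 ≤ k) (g : ℕ) (g≥1 : 1 ≤ g) where

    open Residues pr k

    N : ℕ
    N = p ℕ.^ g

    instance
      N≢0 : ℕ.NonZero N
      N≢0 = ℕP.m^n≢0 p g {{prime⇒nonZero pr}}

    N>0 : 0 < N
    N>0 = ℕ.>-nonZero⁻¹ N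

    %N-mod : ∀ a → + (a % N) ≡ + a [mod + N ]
    %N-mod a = mod-sym (≡-mod-% (+ a))

    mod⇒%≡ : ∀ {a b} → + a ≡ + b [mod + N ] → a % N ≡ b % N
    mod⇒%≡ {a} {b} a≡b = mod-<-injective (m%n<n a N) (m%n<n b N) (mod-trans (%N-mod a) (mod-trans a≡b (mod-sym (%N-mod b))))

    -- isSum j x: the residue x < N is a sum of j k-th powers modulo N.
    isSum : ℕ → ℕ → Bool
    isSum zero x = does (x ≟ 0)
    isSum (suc j) x = anyBelow N (λ y → isSum j y ∧ anyBelow N (λ v → does ((y ℕ.+ v ℕ.^ k) % N ≟ x)))

    isSum-suc-intro : ∀ j x y v → y < N → isSum j y ≡ true → v < N → (y ℕ.+ v ℕ.^ k) % N ≡ x → isSum (suc j) x ≡ true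
    isSum-suc-intro j x y v y<N sum-y v<N y+v^k≡x =
      anyBelow-intro N _ y y<N (cong₂ _∧_ sum-y (anyBelow-intro N _ v v<N (dec-true ((y ℕ.+ v ℕ.^ k) % N ≟ x) y+v^k≡x)))

    isSum-suc-elim : ∀ j x → isSum (suc j) x ≡ true →
      Σ ℕ λ y → y < N × isSum j y ≡ true × Σ ℕ λ v → v < N × (y ℕ.+ v ℕ.^ k) % N ≡ x
    isSum-suc-elim j x sum-x =
      let y<N , y-ok = witnessBelow-spec N _ sum-x
          sum-y , some-v = ∧≡true y-ok
          v<N , v-ok = witnessBelow-spec N _ some-v
      in _ , y<N , sum-y , _ , v<N , does≡true⇒ (_ ≟ x) v-ok

    isSum-< : ∀ j x → isSum j x ≡ true → x < N
    isSum-< zero x sum-x rewrite does≡true⇒ (x ≟ 0) sum-x = N>0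
    isSum-< (suc j) x sum-x = let _ , _ , _ , v , _ , y+v^k≡x = isSum-suc-elim j x sum-x in
      subst (_< N) y+v^k≡x (m%n<n _ N)

    0^k≡0 : 0 ℕ.^ k ≡ 0
    0^k≡0 = 0^n≡0 k {{ℕ.>-nonZero k≥1}}

    isSum-0 : ∀ j → isSum j 0 ≡ true
    isSum-0 zero = refl
    isSum-0 (suc j) = isSum-suc-intro j 0 0 0 N>0 (isSum-0 j) N>0 (trans (cong (_% N) 0^k≡0) (m<n⇒m%n≡m N>0))

    isSum-suc : ∀ j x → isSum j x ≡ true → isSum (suc j) x ≡ true
    isSum-suc j x sum-x = isSum-suc-intro j x x 0 x<N sum-x N>0
      (trans (cong (λ z → (x ℕ.+ z) % N) 0^k≡0) (trans (cong (_% N) (ℕP.+-identityʳ x)) (m<n⇒m%n≡m x<N)))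
      where x<N = isSum-< j x sum-x

    isSum-+1 : ∀ j x → isSum j x ≡ true → isSum (suc j) ((x ℕ.+ 1) % N) ≡ true
    isSum-+1 j x sum-x = isSum-suc-intro j _ x (1 % N) (isSum-< j x sum-x) sum-x (m%n<n 1 N) (mod⇒%≡ (begin
      + (x ℕ.+ (1 % N) ℕ.^ k)    ≡⟨ trans (ℤP.pos-+ x _) (cong (λ z → + x + z) (pos-^ (1 % N) k)) ⟩
      + x + (+ (1 % N)) ^ k      ≈⟨ +-cong-mod (mod-refl {a = + x}) (^-cong-mod (%N-mod 1) k) ⟩
      + x + 1ℤ ^ k               ≡⟨ cong (λ z → + x + z) (ℤP.^-zeroˡ k) ⟩
      + x + 1ℤ                   ≡⟨ ℤP.pos-+ x 1 ⟨
      + (x ℕ.+ 1)                ∎))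
      where open SetoidReasoning (mod-setoid (+ N))

    isSum-* : ∀ w j x → isSum j x ≡ true → isSum j ((w ℕ.^ k ℕ.* x) % N) ≡ true
    isSum-* w zero x sum-x rewrite does≡true⇒ (x ≟ 0) sum-x | ℕP.*-zeroʳ (w ℕ.^ k) | m<n⇒m%n≡m N>0 = refl
    isSum-* w (suc j) x sum-x with isSum-suc-elim j x sum-x
    ... | y , y<N , sum-y , v , v<N , y+v^k≡x =
      isSum-suc-intro j _ y′ v′ (m%n<n _ N) (isSum-* w j y sum-y) (m%n<n _ N) (mod⇒%≡ (begin
        + (y′ ℕ.+ v′ ℕ.^ k)                  ≡⟨ trans (ℤP.pos-+ y′ _) (cong (λ z → + y′ + z) (pos-^ v′ k)) ⟩
        + y′ + (+ v′) ^ k                    ≈⟨ +-cong-mod (%N-mod _) (^-cong-mod (%N-mod _) k) ⟩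
        + (w ℕ.^ k ℕ.* y) + (+ (w ℕ.* v)) ^ k
          ≡⟨ cong₂ _+_ (trans (ℤP.pos-* (w ℕ.^ k) y) (cong (_* + y) (pos-^ w k))) (cong (_^ k) (ℤP.pos-* w v)) ⟩
        W * + y + (+ w * + v) ^ k            ≡⟨ cong (λ z → W * + y + z) (^-distribʳ-* (+ w) (+ v) k) ⟩
        W * + y + W * (+ v) ^ k              ≡⟨ ℤP.*-distribˡ-+ W (+ y) ((+ v) ^ k) ⟨
        W * (+ y + (+ v) ^ k)                ≡⟨ cong (W *_) (trans (ℤP.pos-+ y _) (cong (λ z → + y + z) (pos-^ v k))) ⟨
        W * + (y ℕ.+ v ℕ.^ k)                ≈⟨ *-cong-mod (mod-refl {a = W}) (%N-mod _) ⟨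
        W * + ((y ℕ.+ v ℕ.^ k) % N)          ≡⟨ cong (λ z → W * + z) y+v^k≡x ⟩
        W * + x                              ≡⟨ trans (ℤP.pos-* (w ℕ.^ k) x) (cong (_* + x) (pos-^ w k)) ⟨
        + (w ℕ.^ k ℕ.* x)                    ∎))
      where
      open SetoidReasoning (mod-setoid (+ N))
      y′ = (w ℕ.^ k ℕ.* y) % N
      v′ = (w ℕ.* v) % N
      W = (+ w) ^ k

    isSum-*⁻¹ : ∀ w → Unit p (+ w) → ∀ j x → x < N → isSum j ((w ℕ.^ k ℕ.* x) % N) ≡ true → isSum j x ≡ true
    isSum-*⁻¹ w uw j x x<N sum-wx with inverse-mod pr uw g
    ... | b , wb≡1 = subst (λ z → isSum j z ≡ true) (trans (mod⇒%≡ b^k[w^kx]≡x) (m<n⇒m%n≡m x<N)) (isSum-* w′ j _ sum-wx)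
      where
      open SetoidReasoning (mod-setoid (+ N))
      w′ = b ℤ.% + N
      z = (w ℕ.^ k ℕ.* x) % N
      b^k[w^kx]≡x : + (w′ ℕ.^ k ℕ.* z) ≡ + x [mod + N ]
      b^k[w^kx]≡x = begin
        + (w′ ℕ.^ k ℕ.* z)             ≡⟨ trans (ℤP.pos-* (w′ ℕ.^ k) z) (cong (_* + z) (pos-^ w′ k)) ⟩
        (+ w′) ^ k * + z               ≈⟨ *-cong-mod (^-cong-mod (mod-sym (≡-mod-% b)) k) (%N-mod _) ⟩
        b ^ k * + (w ℕ.^ k ℕ.* x)      ≡⟨ cong (b ^ k *_) (trans (ℤP.pos-* (w ℕ.^ k) x) (cong (_* + x) (pos-^ w k))) ⟩
        b ^ k * ((+ w) ^ k * + x)      ≡⟨ ℤP.*-assoc (b ^ k) ((+ w) ^ k) (+ x) ⟨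
        b ^ k * (+ w) ^ k * + x        ≡⟨ cong (_* + x) (trans (sym (^-distribʳ-* b (+ w) k)) (cong (_^ k) (ℤP.*-comm b (+ w)))) ⟩
        (+ w * b) ^ k * + x            ≈⟨ *-cong-mod (^-cong-mod wb≡1 k) (mod-refl {a = + x}) ⟩
        1ℤ ^ k * + x                   ≡⟨ trans (cong (_* + x) (ℤP.^-zeroˡ k)) (ℤP.*-identityˡ (+ x)) ⟩
        + x                            ∎

    -- If no residue needs j + 1 summands, every residue is a sum of j: climb from 0 by steps of 1.
    isSum-stable⇒all : ∀ j → (∀ x → x < N → isSum (suc j) x ≡ true → isSum j x ≡ true) → ∀ x → x < N → isSum j x ≡ true
    isSum-stable⇒all j stable zero _ = isSum-0 j
    isSum-stable⇒all j stable (suc x) 1+x<N = stable (suc x) 1+x<N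
      (subst (λ z → isSum (suc j) z ≡ true) x+1%N≡1+x (isSum-+1 j x (isSum-stable⇒all j stable x (ℕP.<-trans (ℕP.n<1+n x) 1+x<N))))
      where x+1%N≡1+x = trans (cong (_% N) (ℕP.+-comm x 1)) (m<n⇒m%n≡m 1+x<N)

    isSum⇒powerSum : ∀ j x → isSum j x ≡ true → Σ (Vec ℤ j) λ ys → + x ≡ powerSum k ys [mod + N ]
    isSum⇒powerSum zero x sum-x rewrite does≡true⇒ (x ≟ 0) sum-x = [] , mod-refl
    isSum⇒powerSum (suc j) x sum-x with isSum-suc-elim j x sum-x
    ... | y , y<N , sum-y , v , v<N , y+v^k≡x with isSum⇒powerSum j y sum-y
    ... | ys , y≡Σys = + v ∷ ys , (begin
      + x                           ≡⟨ cong +_ y+v^k≡x ⟨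
      + ((y ℕ.+ v ℕ.^ k) % N)       ≈⟨ %N-mod _ ⟩
      + (y ℕ.+ v ℕ.^ k)             ≡⟨ trans (ℤP.pos-+ y _) (cong (λ z → + y + z) (pos-^ v k)) ⟩
      + y + (+ v) ^ k               ≈⟨ +-cong-mod y≡Σys (mod-refl {a = (+ v) ^ k}) ⟩
      powerSum k ys + (+ v) ^ k     ≡⟨ ℤP.+-comm (powerSum k ys) _ ⟩
      (+ v) ^ k + powerSum k ys     ∎)
      where open SetoidReasoning (mod-setoid (+ N))

    r : ℕ
    r = count isPower p

    root-power-injective : ∀ c c′ → c < p → c′ < p → isPower c ≡ true → isPower c′ ≡ true →
      + (root c ℕ.^ k) ≡ + (root c′ ℕ.^ k) [mod + p ] → c ≡ c′
    root-power-injective c c′ c<p c′<p power power′ roots≡ = mod-<-injective c<p c′<p (begin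
      + c                   ≈⟨ mod-sym (root-power c power) ⟩
      + (root c ℕ.^ k)      ≈⟨ roots≡ ⟩
      + (root c′ ℕ.^ k)     ≈⟨ root-power c′ power′ ⟩
      + c′                  ∎)
      where open SetoidReasoning (mod-setoid (+ p))

    orbit-injective : ∀ x → x < N → x ≢ 0 → ∀ c c′ → c < p → c′ < p → isPower c ≡ true → isPower c′ ≡ true →
      (root c ℕ.^ k ℕ.* x) % N ≡ (root c′ ℕ.^ k ℕ.* x) % N → c ≡ c′
    orbit-injective x x<N x≢0 c c′ c<p c′<p power power′ orbit≡ with c ≟ c′
    ... | yes c≡c′ = c≡c′
    ... | no c≢c′ = ⊥-elim (x≢0 (mod-<-injective x<N N>0 (unit-cancel-mod pr A-B-unit g Ax-Bx≡0)))
      where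
      open SetoidReasoning (mod-setoid (+ N))
      A = + (root c ℕ.^ k)
      B = + (root c′ ℕ.^ k)
      A-B-unit : Unit p (A - B)
      A-B-unit A-B≡0 = c≢c′ (root-power-injective c c′ c<p c′<p power power′ (-≡0-mod⇒mod A-B≡0))
      Ax≡Bx : A * + x ≡ B * + x [mod + N ]
      Ax≡Bx = begin
        A * + x                           ≡⟨ ℤP.pos-* (root c ℕ.^ k) x ⟨
        + (root c ℕ.^ k ℕ.* x)            ≈⟨ %N-mod _ ⟨
        + ((root c ℕ.^ k ℕ.* x) % N)      ≡⟨ cong +_ orbit≡ ⟩
        + ((root c′ ℕ.^ k ℕ.* x) % N)     ≈⟨ %N-mod _ ⟩
        + (root c′ ℕ.^ k ℕ.* x)           ≡⟨ ℤP.pos-* (root c′ ℕ.^ k) x ⟩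
        B * + x                           ∎
      Ax-Bx≡0 : (A - B) * + x ≡ 0ℤ [mod p ^ᶻ g ]
      Ax-Bx≡0 = subst (_≡ 0ℤ [mod + N ]) (lemma A B (+ x)) (mod⇒-≡0-mod Ax≡Bx)
        where lemma : ∀ A B x → A * x - B * x ≡ (A - B) * x
              lemma = solve-∀

    newSum : ℕ → ℕ → Bool
    newSum j y = isSum (suc j) y ∧ not (isSum j y)

    -- A new sum x of j + 1 powers brings its whole orbit {w^k x : w unit} of r new sums with it.
    new-orbit : ∀ j x → x < N → isSum (suc j) x ≡ true → isSum j x ≡ false →
      r ≤ count (newSum j) N
    new-orbit j x x<N new old = count-injection (λ c → (root c ℕ.^ k ℕ.* x) % N) N p
      (λ c c<p power → m%n<n _ N , cong₂ _∧_ (isSum-* (root c) (suc j) x new) (cong not (still-new c c<p power)))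
      (λ c c′ c<p c′<p → orbit-injective x x<N x≢0 c c′ c<p c′<p)
      where
      x≢0 : x ≢ 0
      x≢0 refl = true≢false (trans (sym (isSum-0 j)) old)
      still-new : ∀ c → c < p → isPower c ≡ true → isSum j ((root c ℕ.^ k ℕ.* x) % N) ≡ false
      still-new c c<p power with isSum j ((root c ℕ.^ k ℕ.* x) % N) in old-cx
      ... | false = refl
      ... | true = ⊥-elim (true≢false (trans (sym (isSum-*⁻¹ (root c) (root-unit c power) j x x<N old-cx)) old))

    isSum-growth : ∀ j → (∀ x → x < N → isSum j x ≡ true) ⊎ (1 ℕ.+ j ℕ.* r ≤ count (isSum j) N)
    isSum-growth zero = inj₂ (∃⇒count≥1 (isSum 0) N 0 N>0 refl)
    isSum-growth (suc j) with isSum-growth j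
    ... | inj₁ all = inj₁ (λ x x<N → isSum-suc j x (all x x<N))
    ... | inj₂ grown with anyBelow N (newSum j) in some-new
    ...   | false = inj₁ (λ x x<N → isSum-suc j x (isSum-stable⇒all j stable x x<N))
      where
      stable : ∀ x → x < N → isSum (suc j) x ≡ true → isSum j x ≡ true
      stable x x<N sum-x = trans (sym (not-involutive _))
        (cong not (trans (sym (cong (_∧ not (isSum j x)) sum-x)) (anyBelow-false N (newSum j) some-new x x<N)))
    ...   | true = inj₂ (begin
      1 ℕ.+ suc j ℕ.* r                                           ≡⟨ lemma j r ⟩
      (1 ℕ.+ j ℕ.* r) ℕ.+ r                                       ≤⟨ ℕP.+-mono-≤ grown′ (new-orbit j x x<N sum-x (not≡true⇒≡false not-old)) ⟩
      count (λ y → isSum (suc j) y ∧ isSum j y) N ℕ.+ count (newSum j) N ≡⟨ count-split (isSum (suc j)) (isSum j) N ⟨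
      count (isSum (suc j)) N                                     ∎)
      where
      open ℕP.≤-Reasoning
      x = witnessBelow N (newSum j)
      x<N = proj₁ (witnessBelow-spec N (newSum j) some-new)
      sum-x = proj₁ (∧≡true (proj₂ (witnessBelow-spec N (newSum j) some-new)))
      not-old = proj₂ (∧≡true (proj₂ (witnessBelow-spec N (newSum j) some-new)))
      grown′ : 1 ℕ.+ j ℕ.* r ≤ count (λ y → isSum (suc j) y ∧ isSum j y) N
      grown′ = ℕP.≤-trans grown (count-mono N (λ y y<N sum-y → cong₂ _∧_ (isSum-suc j y sum-y) sum-y))
      lemma : ∀ j r → 1 ℕ.+ suc j ℕ.* r ≡ (1 ℕ.+ j ℕ.* r) ℕ.+ r
      lemma = ℕSolver.solve-∀

    module _ (s : ℕ) (N≤[1+s]r : N ≤ suc s ℕ.* r) (n : ℤ) where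

      shift : ℕ → ℕ
      shift c = (n - + (root c ℕ.^ k)) ℤ.% + N

      shift<N : ∀ c → shift c < N
      shift<N c = ℤDM.n%d<d (n - + (root c ℕ.^ k)) (+ N)

      n≡root^k+shift : ∀ c → n ≡ + (root c ℕ.^ k) + + shift c [mod + N ]
      n≡root^k+shift c = begin
        n                                  ≡⟨ lemma n (+ (root c ℕ.^ k)) ⟩
        + (root c ℕ.^ k) + (n - + (root c ℕ.^ k)) ≈⟨ +-cong-mod (mod-refl {a = + (root c ℕ.^ k)}) (≡-mod-% (n - + (root c ℕ.^ k))) ⟩
        + (root c ℕ.^ k) + + shift c       ∎
        where
        open SetoidReasoning (mod-setoid (+ N))
        lemma : ∀ n a → n ≡ a + (n - a)
        lemma = solve-∀

      shift-injective : ∀ c c′ → c < p → c′ < p → isPower c ≡ true → isPower c′ ≡ true → shift c ≡ shift c′ → c ≡ c′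
      shift-injective c c′ c<p c′<p power power′ shift≡ = root-power-injective c c′ c<p c′<p power power′ (^ᶻ-mod⇒mod g≥1
        (+-cancelʳ-mod (+ shift c) (begin
          + (root c ℕ.^ k) + + shift c     ≈⟨ mod-sym (n≡root^k+shift c) ⟩
          n                                ≈⟨ n≡root^k+shift c′ ⟩
          + (root c′ ℕ.^ k) + + shift c′   ≡⟨ cong (λ z → + (root c′ ℕ.^ k) + + z) shift≡ ⟨
          + (root c′ ℕ.^ k) + + shift c    ∎)))
        where open SetoidReasoning (mod-setoid (+ N))

      found? : ℕ → Bool
      found? c = isPower c ∧ isSum s (shift c)

      -- If no c works, the r distinct residues n − root(c)^k are non-sums: too many beside the ≥ 1 + s r sums.
      some-found : anyBelow p found? ≡ true
      some-found with anyBelow p found? in found | isSum-growth s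
      ... | true | _ = refl
      ... | false | inj₁ all =
        ⊥-elim (true≢false (trans (sym (cong₂ _∧_ power (all (shift c) (shift<N c)))) (anyBelow-false p found? found c c<p)))
        where
        r>0 : 0 < r
        r>0 = ℕP.n≢0⇒n>0 (λ r≡0 → ℕP.<⇒≱ N>0 (subst (N ≤_) (ℕP.*-zeroʳ (suc s)) (subst (λ z → N ≤ suc s ℕ.* z) r≡0 N≤[1+s]r)))
        c = proj₁ (count>0⇒∃ isPower p r>0)
        c<p = proj₁ (proj₂ (count>0⇒∃ isPower p r>0))
        power = proj₂ (proj₂ (count>0⇒∃ isPower p r>0))
      ... | false | inj₂ grown = ⊥-elim (ℕP.<-irrefl refl (ℕP.≤-trans [1+s]r<N N≤[1+s]r))
        where
        open ℕP.≤-Reasoning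
        non-sums : r ≤ count (λ x → not (isSum s x)) N
        non-sums = count-injection shift N p
          (λ c c<p power → shift<N c , cong not (trans (sym (cong (_∧ isSum s (shift c)) power)) (anyBelow-false p found? found c c<p)))
          shift-injective
        [1+s]r<N : suc s ℕ.* r < N
        [1+s]r<N = begin-strict
          suc s ℕ.* r                                          ≡⟨ ℕP.+-comm r (s ℕ.* r) ⟩
          s ℕ.* r ℕ.+ r                                        <⟨ ℕP.+-monoˡ-< r (ℕP.n<1+n _) ⟩
          (1 ℕ.+ s ℕ.* r) ℕ.+ r                                ≤⟨ ℕP.+-mono-≤ grown non-sums ⟩
          count (isSum s) N ℕ.+ count (λ x → not (isSum s x)) N ≡⟨ count-complement (isSum s) N ⟩
          N                                                    ∎

      representable-mod-p^g : Representable p k s g n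
      representable-mod-p^g = + root c , root-unit c power , ys , (begin
        n                                    ≈⟨ n≡root^k+shift c ⟩
        + (root c ℕ.^ k) + + shift c         ≈⟨ +-cong-mod (mod-refl {a = + (root c ℕ.^ k)}) shift≡Σys ⟩
        + (root c ℕ.^ k) + powerSum k ys     ≡⟨ cong (_+ powerSum k ys) (pos-^ (root c) k) ⟩
        (+ root c) ^ k + powerSum k ys       ∎)
        where
        open SetoidReasoning (mod-setoid (+ N))
        c = witnessBelow p found?
        c<p,found = witnessBelow-spec p found? some-found
        power = proj₁ (∧≡true (proj₂ c<p,found))
        ys = proj₁ (isSum⇒powerSum s (shift c) (proj₂ (∧≡true (proj₂ c<p,found))))
        shift≡Σys = proj₂ (isSum⇒powerSum s (shift c) (proj₂ (∧≡true (proj₂ c<p,found))))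

module Valuation where

  open import Data.Nat as ℕ using (ℕ; zero; suc; _≤_; _+_; _*_; _^_; _∸_)
  import Data.Nat.Properties as ℕP
  open import Data.Nat.Divisibility as ℕD using (divides; _∣_; _∣?_)
  open import Data.Nat.Coprimality using (Coprime; coprime-divisor)
  open import Data.Nat.GCD using (gcd; gcd-greatest; gcd[m,n]∣m; gcd[m,n]∣n; gcd[m,n]≢0)
  open import Data.Nat.Primality using (Prime; prime⇒nonZero; prime⇒nonTrivial)
  open import Data.Nat.Tactic.RingSolver using (solve-∀)
  open import Data.Integer using (+_)
  open import Data.Product using (Σ; ∃; _,_; _×_)
  open import Data.Sum using (inj₁)
  open import Data.Empty using (⊥-elim)
  open import Relation.Nullary using (¬_; yes; no)
  open import Relation.Binary.PropositionalEquality
  open import Defs using (ExactPow)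
  open Congruence using (Unit; ≡0-mod⇒∣)

  [1+p′]^τ≡1+p′Q : ∀ p′ τ → ∃ λ Q → suc p′ ^ τ ≡ p′ * Q + 1
  [1+p′]^τ≡1+p′Q p′ zero = 0 , cong (_+ 1) (sym (ℕP.*-zeroʳ p′))
  [1+p′]^τ≡1+p′Q p′ (suc τ) with [1+p′]^τ≡1+p′Q p′ τ
  ... | Q , eq = 1 + Q + p′ * Q , trans (cong (suc p′ *_) eq) (lemma p′ Q)
    where lemma : ∀ p′ Q → suc p′ * (p′ * Q + 1) ≡ p′ * (1 + Q + p′ * Q) + 1
          lemma = solve-∀

  coprime-[1+p′]^τ : ∀ p′ τ d → d ∣ p′ → Coprime d (suc p′ ^ τ)
  coprime-[1+p′]^τ p′ τ d d∣p′ {i} (i∣d , i∣p^τ) with [1+p′]^τ≡1+p′Q p′ τ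
  ... | Q , p^τ≡1+p′Q = ℕD.∣1⇒≡1 (ℕD.∣m+n∣m⇒∣n (subst (i ∣_) p^τ≡1+p′Q i∣p^τ) (ℕD.∣-trans i∣d (ℕD.∣-trans d∣p′ (ℕD.∣m⇒∣m*n Q ℕD.∣-refl))))

  [1+p′]^τ*d∣ : ∀ p′ τ d x → d ∣ p′ → suc p′ ^ τ ∣ x → d ∣ x → suc p′ ^ τ * d ∣ x
  [1+p′]^τ*d∣ p′ τ d x d∣p′ (divides a x≡a*p^τ) d∣x
    with coprime-divisor (coprime-[1+p′]^τ p′ τ d d∣p′) (subst (d ∣_) (trans x≡a*p^τ (ℕP.*-comm a _)) d∣x)
  ... | divides b a≡b*d = divides b (trans x≡a*p^τ (trans (cong (_* suc p′ ^ τ) a≡b*d) (lemma b d (suc p′ ^ τ))))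
    where lemma : ∀ b d P → b * d * P ≡ b * (P * d)
          lemma = solve-∀

  module _ {p : ℕ} (pr : Prime p) where

    exactPow⇒cofactor : ∀ τ K → 1 ≤ K → ExactPow p τ K → Σ ℕ λ m → K ≡ p ^ τ * m × 1 ≤ m × Unit p (+ m)
    exactPow⇒cofactor τ K K≥1 (divides m K≡m*p^τ , p^[1+τ]∤K) = m , trans K≡m*p^τ (ℕP.*-comm m (p ^ τ)) , m≥1 , unit-m
      where
      m≥1 : 1 ≤ m
      m≥1 = ℕP.n≢0⇒n>0 (λ m≡0 → ℕP.<⇒≱ K≥1 (ℕP.≤-reflexive (trans K≡m*p^τ (cong (_* p ^ τ) m≡0))))
      unit-m : Unit p (+ m)
      unit-m m≡0 with ≡0-mod⇒∣ m≡0
      ... | divides j m≡j*p = p^[1+τ]∤K (divides j (trans K≡m*p^τ (trans (cong (_* p ^ τ) m≡j*p) (lemma j p (p ^ τ)))))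
        where lemma : ∀ j p P → j * p * P ≡ j * (p * P)
              lemma = solve-∀

    valuation : ∀ l → 1 ≤ l → ∃ λ τ → ExactPow p τ l
    valuation l l≥1 = go l l ℕP.≤-refl l≥1
      where
      go : ∀ fuel l → l ≤ fuel → 1 ≤ l → ∃ λ τ → ExactPow p τ l
      go fuel l l≤fuel l≥1 with p ∣? l
      ... | no p∤l = 0 , ℕD.1∣ l , (λ p^1∣l → p∤l (subst (_∣ l) (ℕP.*-identityʳ p) p^1∣l))
      go zero l l≤0 l≥1 | yes _ = ⊥-elim (ℕP.<⇒≱ l≥1 l≤0)
      go (suc fuel) l l≤fuel l≥1 | yes (divides j l≡j*p) with go fuel j j≤fuel j≥1
        where
        j≥1 : 1 ≤ j
        j≥1 = ℕP.n≢0⇒n>0 (λ j≡0 → ℕP.<⇒≱ l≥1 (ℕP.≤-reflexive (trans l≡j*p (cong (_* p) j≡0))))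
        j≤fuel : j ≤ fuel
        j≤fuel = ℕP.≤-pred (ℕP.<-≤-trans (ℕP.<-≤-trans (ℕP.m<m*n j p {{ℕ.>-nonZero j≥1}} (ℕ.nonTrivial⇒n>1 p {{prime⇒nonTrivial pr}}))
                                                         (ℕP.≤-reflexive (sym l≡j*p))) l≤fuel)
      ... | τ , divides a j≡a*p^τ , p^[1+τ]∤j = suc τ , divides a (trans l≡j*p (trans (cong (_* p) j≡a*p^τ) (lemma a (p ^ τ) p))) , p^[2+τ]∤l
        where
        lemma : ∀ a P p → a * P * p ≡ a * (p * P)
        lemma = solve-∀
        p^[2+τ]∤l : ¬ (p ^ suc (suc τ) ∣ l)
        p^[2+τ]∤l (divides b l≡b*p^[2+τ]) = p^[1+τ]∤j (divides b (ℕP.*-cancelʳ-≡ j (b * p ^ suc τ) p {{prime⇒nonZero pr}}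
                                                            (trans (sym l≡j*p) (trans l≡b*p^[2+τ] (lemma′ b p (p ^ τ))))))
          where lemma′ : ∀ b p P → b * (p * (p * P)) ≡ b * (p * P) * p
                lemma′ = solve-∀

  p^τ*gcd≤gcd : ∀ {p} .{{_ : ℕ.NonZero p}} → ∀ τ K → 1 ≤ K → p ^ τ ∣ K → p ^ τ * gcd K (p ∸ 1) ≤ gcd K (p ^ τ * (p ∸ 1))
  p^τ*gcd≤gcd {suc p′} τ K K≥1 p^τ∣K =
    ℕD.∣⇒≤ {{ℕ.≢-nonZero (gcd[m,n]≢0 K _ (inj₁ (λ K≡0 → ℕP.<⇒≱ K≥1 (ℕP.≤-reflexive K≡0))))}}
      ([1+p′]^τ*d∣ p′ τ (gcd K p′) (gcd K (suc p′ ^ τ * p′)) (gcd[m,n]∣n K p′)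
        (gcd-greatest p^τ∣K (ℕD.∣m⇒∣m*n p′ ℕD.∣-refl))
        (gcd-greatest (gcd[m,n]∣m K p′) (ℕD.∣-trans (gcd[m,n]∣n K p′) (ℕD.∣n⇒∣m*n (suc p′ ^ τ) ℕD.∣-refl))))

  p^τ*gcd≤ : ∀ {p} .{{_ : ℕ.NonZero p}} → ∀ τ l → 1 ≤ l → p ^ τ ∣ l → p ^ τ * gcd l (p ∸ 1) ≤ l
  p^τ*gcd≤ {suc p′} τ l l≥1 p^τ∣l =
    ℕD.∣⇒≤ {{ℕ.≢-nonZero (λ l≡0 → ℕP.<⇒≱ l≥1 (ℕP.≤-reflexive l≡0))}}
      ([1+p′]^τ*d∣ p′ τ (gcd l p′) l (gcd[m,n]∣n l p′) p^τ∣l (gcd[m,n]∣m l p′))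

module Waring where

  open import Data.Nat as ℕ using (ℕ; zero; suc; _≤_; _<_; _>_; z≤n; s≤s; _≟_; _+_; _*_; _^_; _∸_)
  import Data.Nat.Properties as ℕP
  open import Data.Nat.DivMod using (_%_; m<n⇒m%n≡m)
  open import Data.Nat.Divisibility using (_∣_)
  open import Data.Nat.GCD using (gcd)
  open import Data.Nat.Primality using (Prime; prime⇒nonZero; prime?)
  open import Data.Nat.Tactic.RingSolver as ℕSolver using ()
  open import Data.Integer as ℤ using (+_; -_; 0ℤ; 1ℤ)
  import Data.Integer.Properties as ℤP
  import Data.Integer.DivMod as ℤDM
  open import Data.Integer.Tactic.RingSolver using (solve-∀)
  open import Data.Vec using (_∷_; replicate)
  open import Data.Bool using (true)
  open import Data.Product using (_,_; proj₁; proj₂)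
  open import Data.Empty using (⊥-elim)
  open import Relation.Nullary using (yes; no)
  open import Relation.Nullary.Decidable using (dec-true; from-yes)
  open import Relation.Binary.PropositionalEquality
  import Relation.Binary.Reasoning.Setoid as SetoidReasoning
  open import Defs using (ExactPow; gammaOf)
  open Congruence
  open Counting using (count; anyBelow-intro; ∃⇒count≥1)
  open Hensel using (lift-kth-power-≥)
  open PowerResidues using (module Residues)
  open SumsOfPowers
  open Valuation

  module _ {p : ℕ} (pr : Prime p) (τ m : ℕ) (um : Unit p (+ m)) (s γ : ℕ)
           (τ<γ : τ < γ) (γ≥τ+2 : p ≡ 2 → 1 ≤ τ → 2 + τ ≤ γ) where

    private
      k = p ^ τ * m

    representable-suc : ∀ {h n} → γ ≤ h → Representable p k s h n → Representable p k s (suc h) n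
    representable-suc {h} {n} γ≤h (w , uw , ys , n≡w^k+Σ) = w′ , uw′ , ys , (begin
      n                 ≡⟨ lemma₁ n S ⟩
      n ℤ.- S ℤ.+ S     ≈⟨ +-cong-mod n-Σ≡w′^k (mod-refl {a = S}) ⟩
      w′ ℤ.^ k ℤ.+ S    ∎)
      where
      open SetoidReasoning (mod-setoid (p ^ᶻ suc h))
      S = powerSum k ys
      lemma₁ : ∀ n S → n ≡ n ℤ.- S ℤ.+ S
      lemma₁ = solve-∀
      lemma₂ : ∀ W S → W ℤ.+ S ℤ.- S ≡ W
      lemma₂ = solve-∀
      n-Σ≡w^k : n ℤ.- S ≡ w ℤ.^ k [mod p ^ᶻ h ]
      n-Σ≡w^k = subst (λ z → n ℤ.- S ≡ z [mod p ^ᶻ h ]) (lemma₂ (w ℤ.^ k) S) (+-cong-mod n≡w^k+Σ (mod-refl {a = ℤ.- S}))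
      lifted = lift-kth-power-≥ pr τ m um h (ℕP.<-≤-trans τ<γ γ≤h) (λ p≡2 τ≥1 → ℕP.≤-trans (γ≥τ+2 p≡2 τ≥1) γ≤h) uw n-Σ≡w^k
      w′ = proj₁ lifted
      uw′ = proj₁ (proj₂ lifted)
      n-Σ≡w′^k = proj₂ (proj₂ lifted)

    representable-lift : (∀ n → Representable p k s γ n) → ∀ h n → Representable p k s h n
    representable-lift base h n with h ℕ.≤? γ
    ... | yes h≤γ = let w , uw , ys , n≡ = base n in w , uw , ys , ^ᶻ-mono-mod h≤γ n≡
    representable-lift base zero n | no 0≰γ = ⊥-elim (0≰γ z≤n)
    representable-lift base (suc h) n | no h≰γ = representable-suc (ℕP.≤-pred (ℕP.≰⇒> h≰γ)) (representable-lift base h n)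

  module _ {p : ℕ} (pr : Prime p) where

    private instance
      p≢0 : ℕ.NonZero p
      p≢0 = prime⇒nonZero pr

    representable-from-count : ∀ τ m → 1 ≤ m → Unit p (+ m) → ∀ s γ → τ < γ → (p ≡ 2 → 1 ≤ τ → 2 + τ ≤ γ) →
      p ^ γ ≤ suc s * count (Residues.isPower pr (p ^ τ * m)) p → ∀ h n → Representable p (p ^ τ * m) s h n
    representable-from-count τ m m≥1 um s γ τ<γ γ≥τ+2 p^γ≤[1+s]r =
      representable-lift pr τ m um s γ τ<γ γ≥τ+2
        (ModPrimePower.representable-mod-p^g pr (p ^ τ * m) k≥1 γ (ℕP.≤-trans (s≤s z≤n) τ<γ) s p^γ≤[1+s]r)
      where k≥1 = ℕP.≤-trans m≥1 (ℕP.m≤n*m m (p ^ τ) {{ℕP.m^n≢0 p τ}})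

    module _ (K : ℕ) where
      open Residues pr K

      p^[1+τ]≤X*r : ∀ τ X → p * (p ^ τ * e) ≤ X * (p ∸ 1) → p ^ suc τ ≤ X * count isPower p
      p^[1+τ]≤X*r τ X p*p^τ*e≤X[p-1] = ℕP.*-cancelˡ-≤ e {{ℕ.≢-nonZero e≢0}} (begin
        e * p ^ suc τ            ≡⟨ lemma e p (p ^ τ) ⟩
        p * (p ^ τ * e)          ≤⟨ p*p^τ*e≤X[p-1] ⟩
        X * (p ∸ 1)              ≤⟨ ℕP.*-monoʳ-≤ X power-residue-count ⟩
        X * (e * count isPower p) ≡⟨ lemma′ X e (count isPower p) ⟩
        e * (X * count isPower p) ∎)
        where
        open ℕP.≤-Reasoning
        lemma : ∀ e p P → e * (p * P) ≡ p * (P * e)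
        lemma = ℕSolver.solve-∀
        lemma′ : ∀ s e r → s * (e * r) ≡ e * (s * r)
        lemma′ = ℕSolver.solve-∀

      one-isPower : isPower 1 ≡ true
      one-isPower = anyBelow-intro p (unitRoot 1) 1 (2≤p pr) (dec-true ((1 ^ K) % p ≟ 1) 1^K%p≡1)
        where 1^K%p≡1 = trans (cong (_% p) (ℕP.^-zeroˡ K)) (m<n⇒m%n≡m (2≤p pr))

  powerSum-zeros : ∀ k n → powerSum (suc k) (replicate n 0ℤ) ≡ 0ℤ
  powerSum-zeros k zero = refl
  powerSum-zeros k (suc n) = trans (ℤP.+-identityˡ _) (powerSum-zeros k n)

  1+four-squares : ∀ s n a b c d → n ≡ 1ℤ ℤ.+ a ℤ.* a ℤ.+ b ℤ.* b ℤ.+ c ℤ.* c ℤ.+ d ℤ.* d [mod + 8 ] →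
    Representable 2 2 (4 + s) 3 n
  1+four-squares s n a b c d n≡ = 1ℤ , unit-1 (from-yes (prime? 2)) , a ∷ b ∷ c ∷ d ∷ replicate s 0ℤ ,
    subst (λ z → n ≡ z [mod + 8 ]) (sym sum≡) n≡
    where
    -- x ^ 2 appears unfolded as x * (x * 1): the ring solver does not handle _^_.
    lemma : ∀ a b c d → 1ℤ ℤ.* (1ℤ ℤ.* 1ℤ) ℤ.+ (a ℤ.* (a ℤ.* 1ℤ) ℤ.+ (b ℤ.* (b ℤ.* 1ℤ) ℤ.+ (c ℤ.* (c ℤ.* 1ℤ) ℤ.+ (d ℤ.* (d ℤ.* 1ℤ) ℤ.+ 0ℤ)))) ≡
                        1ℤ ℤ.+ a ℤ.* a ℤ.+ b ℤ.* b ℤ.+ c ℤ.* c ℤ.+ d ℤ.* d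
    lemma = solve-∀
    sum≡ : 1ℤ ℤ.^ 2 ℤ.+ powerSum 2 (a ∷ b ∷ c ∷ d ∷ replicate s 0ℤ) ≡ 1ℤ ℤ.+ a ℤ.* a ℤ.+ b ℤ.* b ℤ.+ c ℤ.* c ℤ.+ d ℤ.* d
    sum≡ rewrite powerSum-zeros 1 s = lemma a b c d

  -- 1 + a² + b² + c² + d² with a, b, c, d ∈ {0, 1, 2} runs through all residues modulo 8.
  squares-mod-8 : ∀ s n → Representable 2 2 (4 + s) 3 n
  squares-mod-8 s n with n ℤDM.% + 8 | ℤDM.n%d<d n (+ 8) | ≡-mod-% {8} n
  ... | 0 | _ | n≡0 = 1+four-squares s n (+ 1) (+ 1) (+ 1) (+ 2) (mod-trans n≡0 (- 1ℤ , refl))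
  ... | 1 | _ | n≡1 = 1+four-squares s n (+ 0) (+ 0) (+ 0) (+ 0) n≡1
  ... | 2 | _ | n≡2 = 1+four-squares s n (+ 1) (+ 0) (+ 0) (+ 0) n≡2
  ... | 3 | _ | n≡3 = 1+four-squares s n (+ 1) (+ 1) (+ 0) (+ 0) n≡3
  ... | 4 | _ | n≡4 = 1+four-squares s n (+ 1) (+ 1) (+ 1) (+ 0) n≡4
  ... | 5 | _ | n≡5 = 1+four-squares s n (+ 2) (+ 0) (+ 0) (+ 0) n≡5
  ... | 6 | _ | n≡6 = 1+four-squares s n (+ 2) (+ 1) (+ 0) (+ 0) n≡6
  ... | 7 | _ | n≡7 = 1+four-squares s n (+ 2) (+ 1) (+ 1) (+ 0) n≡7
  ... | suc (suc (suc (suc (suc (suc (suc (suc _))))))) | s≤s (s≤s (s≤s (s≤s (s≤s (s≤s (s≤s (s≤s ()))))))) | _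

  module _ {p : ℕ} (pr : Prime p) (τ m : ℕ) (m≥1 : 1 ≤ m) (um : Unit p (+ m)) (s : ℕ) where

    private
      k = p ^ τ * m
      open Residues pr k

    representable-γ≡1+τ : (p ≡ 2 → τ ≡ 0) → p * (p ^ τ * e) ≤ suc s * (p ∸ 1) → ∀ h n → Representable p k s h n
    representable-γ≡1+τ p≡2⇒τ≡0 bound = representable-from-count pr τ m m≥1 um s (suc τ) ℕP.≤-refl γ≥τ+2
      (p^[1+τ]≤X*r pr k τ (suc s) bound)
      where
      γ≥τ+2 : p ≡ 2 → 1 ≤ τ → 2 + τ ≤ suc τ
      γ≥τ+2 p≡2 τ≥1 with p≡2⇒τ≡0 p≡2
      γ≥τ+2 p≡2 () | refl

    representable-γ≡2+τ : p ≡ 2 → 1 ≤ τ → 2 ^ (2 + τ) ≤ suc s → ∀ h n → Representable p k s h n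
    representable-γ≡2+τ refl τ≥1 bound = representable-from-count pr τ m m≥1 um s (2 + τ) (ℕP.n≤1+n (suc τ)) (λ _ _ → ℕP.≤-refl)
      (ℕP.≤-trans bound (subst (_≤ suc s * count isPower 2) (ℕP.*-identityʳ (suc s))
        (ℕP.*-monoʳ-≤ (suc s) (∃⇒count≥1 isPower 2 1 (s≤s (s≤s z≤n)) (one-isPower pr k)))))

  squares-representable : Prime 2 → ∀ s → 4 ≤ s → ∀ h n → Representable 2 2 s h n
  squares-representable pr s s≥4 = subst (λ s → ∀ h n → Representable 2 2 s h n) (ℕP.m+[n∸m]≡n s≥4)
    (representable-lift pr 1 1 (unit-1 pr) (4 + (s ∸ 4)) 3 (s≤s (s≤s z≤n)) (λ _ _ → ℕP.≤-refl) (squares-mod-8 (s ∸ 4)))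

  gammaOf-odd : ∀ p τ → p ≢ 2 → gammaOf p (suc τ) ≡ suc τ + 1
  gammaOf-odd p τ p≢2 with p ≟ 2
  ... | yes p≡2 = ⊥-elim (p≢2 p≡2)
  ... | no _ = refl

  module _ {p : ℕ} (pr : Prime p) where

    private instance
      p≢0′ : ℕ.NonZero p
      p≢0′ = prime⇒nonZero pr

    gcd-bound : ∀ τ K X → 1 ≤ K → p ^ τ ∣ K → p * gcd K (p ^ τ * (p ∸ 1)) ≤ X → p * (p ^ τ * gcd K (p ∸ 1)) ≤ X
    gcd-bound τ K X K≥1 p^τ∣K = ℕP.≤-trans (ℕP.*-monoʳ-≤ p (p^τ*gcd≤gcd τ K K≥1 p^τ∣K))

    representable-k : ∀ k τ s → 2 ≤ k → ExactPow p τ k →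
      (gammaOf p τ ≡ τ + 1 → p * gcd k (p ^ τ * (p ∸ 1)) ≤ suc s * (p ∸ 1)) →
      (gammaOf p τ ≡ τ + 2 → k > 2 → 2 ^ (τ + 2) ≤ suc s) →
      (p ≡ 2 → k ≡ 2 → 5 ≤ suc s) → ∀ h n → Representable p k s h n
    representable-k k τ s k≥2 exact h₁ h₂ h₃ with exactPow⇒cofactor pr τ k k≥1 exact
      where k≥1 = ℕP.≤-trans (s≤s z≤n) k≥2
    ... | m , refl , m≥1 , um with τ | p ≟ 2
    ... | zero | _ =
      representable-γ≡1+τ pr 0 m m≥1 um s (λ _ → refl) (gcd-bound 0 _ _ (ℕP.≤-trans (s≤s z≤n) k≥2) (proj₁ exact) (h₁ refl))
    ... | suc τ′ | no p≢2 =
      representable-γ≡1+τ pr (suc τ′) m m≥1 um s (λ p≡2 → ⊥-elim (p≢2 p≡2)) (gcd-bound (suc τ′) _ _ (ℕP.≤-trans (s≤s z≤n) k≥2) (proj₁ exact) (h₁ (gammaOf-odd p τ′ p≢2)))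
    ... | suc τ′ | yes refl with 2 ≟ 2 ^ suc τ′ * m
    ...   | yes 2≡k = subst (λ k → ∀ h n → Representable 2 k s h n) 2≡k (squares-representable pr s (ℕP.≤-pred (h₃ refl (sym 2≡k))))
    ...   | no 2≢k = representable-γ≡2+τ pr (suc τ′) m m≥1 um s refl (s≤s z≤n)
                       (subst (λ z → 2 ^ z ≤ suc s) (ℕP.+-comm (suc τ′) 2) (h₂ refl (ℕP.≤∧≢⇒< k≥2 2≢k)))

    four-bound : ∀ τ L X → 1 ≤ L → p ^ τ ∣ L → 4 * L ≤ X → p * (p ^ τ * gcd L (p ∸ 1)) ≤ X * (p ∸ 1)
    four-bound τ L X L≥1 p^τ∣L 4L≤X = begin
      p * (p ^ τ * gcd L (p ∸ 1))   ≤⟨ ℕP.*-monoʳ-≤ p (p^τ*gcd≤ τ L L≥1 p^τ∣L) ⟩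
      p * L                         ≤⟨ ℕP.*-monoˡ-≤ L (p≤4[p-1] p (2≤p pr)) ⟩
      4 * (p ∸ 1) * L               ≡⟨ lemma (p ∸ 1) L ⟩
      4 * L * (p ∸ 1)               ≤⟨ ℕP.*-monoˡ-≤ (p ∸ 1) 4L≤X ⟩
      X * (p ∸ 1)                   ∎
      where
      open ℕP.≤-Reasoning
      p≤4[p-1] : ∀ p → 2 ≤ p → p ≤ 4 * (p ∸ 1)
      p≤4[p-1] (suc zero) (s≤s ())
      p≤4[p-1] (suc (suc q)) _ = subst (suc (suc q) ≤_) (sym (lemma′ q)) (ℕP.m≤m+n (suc (suc q)) (2 + 3 * q))
        where lemma′ : ∀ q → 4 * suc q ≡ suc (suc q) + (2 + 3 * q)
              lemma′ = ℕSolver.solve-∀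
      lemma : ∀ a L → 4 * a * L ≡ 4 * L * a
      lemma = ℕSolver.solve-∀

    representable-l : ∀ l t → 2 ≤ l → 4 * l ≤ suc t → ∀ h n → Representable p l t h n
    representable-l l t l≥2 4l≤t with valuation pr l (ℕP.≤-trans (s≤s z≤n) l≥2)
    ... | τ , exact with exactPow⇒cofactor pr τ l (ℕP.≤-trans (s≤s z≤n) l≥2) exact
    ... | m , refl , m≥1 , um with τ | p ≟ 2
    ... | zero | _ =
      representable-γ≡1+τ pr 0 m m≥1 um t (λ _ → refl) (four-bound 0 _ _ (ℕP.≤-trans (s≤s z≤n) l≥2) (proj₁ exact) 4l≤t)
    ... | suc τ′ | no p≢2 =
      representable-γ≡1+τ pr (suc τ′) m m≥1 um t (λ p≡2 → ⊥-elim (p≢2 p≡2)) (four-bound (suc τ′) _ _ (ℕP.≤-trans (s≤s z≤n) l≥2) (proj₁ exact) 4l≤t)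
    ... | suc τ′ | yes refl = representable-γ≡2+τ pr (suc τ′) m m≥1 um t refl (s≤s z≤n) (begin
      2 ^ (2 + suc τ′)       ≡⟨ ℕP.*-assoc 2 2 (2 ^ suc τ′) ⟨
      4 * 2 ^ suc τ′         ≤⟨ ℕP.*-monoʳ-≤ 4 (ℕP.m≤m*n (2 ^ suc τ′) m {{ℕ.>-nonZero m≥1}}) ⟩
      4 * (2 ^ suc τ′ * m)   ≤⟨ 4l≤t ⟩
      suc t                  ∎)
      where open ℕP.≤-Reasoning

module Box where

  open import Data.Nat as ℕ using (ℕ; zero; suc; _≤_; _<_; _>_; z≤n; s≤s; _^_)
  import Data.Nat.Properties as ℕP
  open import Data.Nat.Divisibility using (_∣_; _∣?_)
  open import Data.Nat.Primality using (Prime; prime⇒nonZero)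
  open import Data.Integer as ℤ using (ℤ; +_; 1ℤ)
  import Data.Integer.Properties as ℤP
  import Data.Integer.DivMod as ℤDM
  open import Data.Integer.Tactic.RingSolver using (solve-∀)
  open import Data.Vec as V using (Vec; []; _∷_)
  open import Data.Vec.Relation.Unary.All as All using (All; []; _∷_)
  import Data.Vec.Relation.Unary.All.Properties as AllP
  open import Data.List as L using (length; filterᵇ)
  open import Data.List.Relation.Unary.Any as Any using (here)
  import Data.List.Relation.Unary.Any.Properties as AnyP
  open import Data.List.Membership.Propositional using (_∈_)
  open import Data.List.Membership.Propositional.Properties using (∈-map⁺; ∈-concatMap⁺; ∈-filter⁺)
  open import Data.Bool using (Bool; T; true; _∧_; not)
  open import Data.Bool.Properties using (T-≡)
  open import Data.Product using (_×_; _,_; proj₁; proj₂)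
  open import Function using (id; _∘_)
  open import Function.Bundles using (Equivalence)
  open import Relation.Nullary using (¬_)
  open import Relation.Nullary.Decidable using (T?; ⌊_⌋; ¬?; isYes≗does; dec-true; dec-false)
  open import Relation.Binary.PropositionalEquality
  open import Defs using (Tpow; boxVecs; boxTuples; good; Mstar)
  open Congruence
  open SumsOfPowers using (powerSum; Representable)

  InBox : ℕ → ∀ {t} → Vec ℕ t → Set
  InBox m = All (λ a → 1 ≤ a × a ≤ m)

  ∈-boxVecs : ∀ m t (x : Vec ℕ t) → InBox m x → x ∈ boxVecs m t
  ∈-boxVecs m zero [] [] = here refl
  ∈-boxVecs m (suc t) (suc a ∷ x) ((s≤s z≤n , a<m) ∷ x-in) =
    ∈-concatMap⁺ (λ a → L.map (a ∷_) (boxVecs m t)) (AnyP.map⁺ (AnyP.applyUpTo⁺ id (∈-map⁺ (suc a ∷_) (∈-boxVecs m t x x-in)) a<m))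

  ∈-boxTuples : ∀ m t s (X : Vec (Vec ℕ t) s) → All (InBox m) X → X ∈ boxTuples m t s
  ∈-boxTuples m t zero [] [] = here refl
  ∈-boxTuples m t (suc s) (x ∷ X) (x-in ∷ X-in) =
    ∈-concatMap⁺ (λ x → L.map (x ∷_) (boxTuples m t s)) (Any.map (λ { refl → ∈-map⁺ (x ∷_) (∈-boxTuples m t s X X-in) }) (∈-boxVecs m t x x-in))

  ∈⇒length>0 : ∀ {A : Set} {x : A} {ys} → x ∈ ys → 0 < length ys
  ∈⇒length>0 {ys = _ L.∷ _} _ = s≤s z≤n

  ∈-filterᵇ⇒length>0 : ∀ {A : Set} (f : A → Bool) {x xs} → x ∈ xs → T (f x) → 0 < length (filterᵇ f xs)
  ∈-filterᵇ⇒length>0 f x∈xs fx = ∈⇒length>0 (∈-filter⁺ (T? ∘ f) x∈xs fx)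

  +sum-^-map : ∀ {A B : Set} {m} (g : B → ℕ) (f : A → B) e (xs : Vec A m) →
    + V.sum (V.map (λ x → g x ℕ.^ e) (V.map f xs)) ≡ powerSum e (V.map (λ x → + g (f x)) xs)
  +sum-^-map g f e [] = refl
  +sum-^-map g f e (x ∷ xs) = trans (ℤP.pos-+ (g (f x) ℕ.^ e) _) (cong₂ ℤ._+_ (pos-^ (g (f x)) e) (+sum-^-map g f e xs))

  powerSum-map-mod : ∀ {q m} e (f : ℤ → ℤ) (xs : Vec ℤ m) → (∀ x → f x ≡ x [mod q ]) → powerSum e (V.map f xs) ≡ powerSum e xs [mod q ]
  powerSum-map-mod e f [] f≡ = mod-refl
  powerSum-map-mod e f (x ∷ xs) f≡ = +-cong-mod (^-cong-mod (f≡ x) e) (powerSum-map-mod e f xs f≡)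

  module _ {p : ℕ} (pr : Prime p) (k l t s ν : ℕ) (ν≥1 : 1 ≤ ν)
           (repK : ∀ n → Representable p k s ν n) (repL : ∀ n → Representable p l t ν n) where

    private
      q = p ^ ν
      instance
        q≢0 : ℕ.NonZero q
        q≢0 = ℕP.m^n≢0 p ν {{prime⇒nonZero pr}}

    toBox : ℤ → ℕ
    toBox a = suc ((a ℤ.- 1ℤ) ℤ.% + q)

    toBox-mod : ∀ a → + toBox a ≡ a [mod + q ]
    toBox-mod a = mod-trans (+-cong-mod (mod-refl {a = 1ℤ}) (mod-sym (≡-mod-% (a ℤ.- 1ℤ)))) (subst (λ z → 1ℤ ℤ.+ (a ℤ.- 1ℤ) ≡ z [mod + q ]) (lemma a) mod-refl)
      where lemma : ∀ a → 1ℤ ℤ.+ (a ℤ.- 1ℤ) ≡ a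
            lemma = solve-∀

    toBox-in : ∀ a → 1 ≤ toBox a × toBox a ≤ q
    toBox-in a = s≤s z≤n , ℤDM.n%d<d (a ℤ.- 1ℤ) (+ q)

    row : ℤ → Vec ℕ (suc t)
    row y = let w , _ , zs , _ = repL y in V.map toBox (w ∷ zs)

    row-in : ∀ y → InBox q (row y)
    row-in y = let w , _ , zs , _ = repL y in AllP.map⁺ (All.universal toBox-in (w ∷ zs))

    Tpow-row : ∀ y → + Tpow l (row y) ≡ y [mod + q ]
    Tpow-row y = let w , _ , zs , y≡ = repL y in
      subst (_≡ y [mod + q ]) (sym (+sum-^-map id toBox l (w ∷ zs)))
            (mod-trans (powerSum-map-mod l (λ x → + toBox x) (w ∷ zs) toBox-mod) (mod-sym y≡))

    tuple : ℤ → Vec (Vec ℕ (suc t)) (suc s)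
    tuple n = let u , _ , ys , _ = repK n in V.map row (u ∷ ys)

    tuple-in : ∀ n → All (InBox q) (tuple n)
    tuple-in n = let u , _ , ys , _ = repK n in AllP.map⁺ (All.universal row-in (u ∷ ys))

    sum-tuple : ∀ n → + V.sum (V.map (λ x → Tpow l x ℕ.^ k) (tuple n)) ≡ n [mod + q ]
    sum-tuple n = let u , _ , ys , n≡ = repK n in
      subst (_≡ n [mod + q ]) (sym (+sum-^-map (Tpow l) row k (u ∷ ys)))
            (mod-trans (powerSum-map-mod k (λ y → + Tpow l (row y)) (u ∷ ys) Tpow-row) (mod-sym n≡))

    first-entry-∤ : ∀ y → ¬ p ∣ toBox (proj₁ (repL y))
    first-entry-∤ y = let w , uw , _ = repL y in unit⇒∤ (unit-resp-mod pr (^ᶻ-mod⇒mod ν≥1 (mod-sym (toBox-mod w))) uw)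

    first-row-∤ : ∀ n → ¬ p ∣ Tpow l (row (proj₁ (repK n)))
    first-row-∤ n = let u , uu , _ = repK n in unit⇒∤ (unit-resp-mod pr (^ᶻ-mod⇒mod ν≥1 (mod-sym (Tpow-row u))) uu)

    good-tuple : ∀ n → good p ν k l n (tuple n) ≡ true
    good-tuple n = cong₂ _∧_ (not-divisible (first-entry-∤ (proj₁ (repK n))))
                             (cong₂ _∧_ (not-divisible (first-row-∤ n))
                                        (trans (isYes≗does (q ∣? _)) (dec-true (q ∣? _) (≡0-mod⇒∣ (mod⇒-≡0-mod (mod-sym (sum-tuple n)))))))
      where not-divisible : ∀ {a} → ¬ p ∣ a → ⌊ ¬? (p ∣? a) ⌋ ≡ true
            not-divisible {a} p∤a = trans (isYes≗does (¬? (p ∣? a))) (cong not (dec-false (p ∣? a) p∤a))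

    Mstar>0 : ∀ n → Mstar k l (suc t) (suc s) n p ν > 0
    Mstar>0 n = ∈-filterᵇ⇒length>0 (good p ν k l n) (∈-boxTuples q (suc t) (suc s) (tuple n) (tuple-in n)) (Equivalence.from T-≡ (good-tuple n))

open import Defs
open import Data.Nat using (ℕ; zero; suc; _+_; _*_; _∸_; _^_; _≤_; _<_; _>_; s≤s; z≤n)
open import Data.Nat.GCD using (gcd)
open import Data.Nat.Primality using (Prime)
open import Data.Integer using (ℤ)
open import Relation.Binary.PropositionalEquality using (_≡_)
import Data.Nat.Properties as ℕP
open import Data.Empty using (⊥-elim)
open Waring using (representable-k; representable-l)
open Box using (Mstar>0)

lemma3p3 : (k l t s : ℕ) (n : ℤ) (p τ τ₁ : ℕ) →
    2 ≤ k → 2 ≤ l → 4 * l ≤ t → 1 ≤ s → Prime p →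
    ExactPow p τ k → ExactPow p τ₁ (k * l) →
    (gammaOf p τ ≡ τ + 1 → p * gcd k (p ^ τ * (p ∸ 1)) ≤ s * (p ∸ 1)) →
    (gammaOf p τ ≡ τ + 2 → k > 2 → 2 ^ (τ + 2) ≤ s) →
    (p ≡ 2 → k ≡ 2 → 5 ≤ s) →
    Mstar k l t s n p (2 * τ₁ + 1) > 0
lemma3p3 k l zero _ _ _ _ _ _ l≥2 4l≤0 _ _ _ _ _ _ _ =
  ⊥-elim (ℕP.<⇒≱ (ℕP.<-≤-trans (s≤s z≤n) (ℕP.*-monoʳ-≤ 4 l≥2)) 4l≤0)
lemma3p3 k l (suc t) (suc s) n p τ τ₁ k≥2 l≥2 4l≤t _ pr exact-k _ h₁ h₂ h₃ =
  Mstar>0 pr k l t s (2 * τ₁ + 1) (ℕP.m≤n+m 1 (2 * τ₁))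
    (representable-k pr k τ s k≥2 exact-k h₁ h₂ h₃ (2 * τ₁ + 1)) (representable-l pr l t l≥2 4l≤t (2 * τ₁ + 1)) n
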